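{- Let $d$ be an odd prime power and $n$ a multiple of $d^2$. Partition the $n$ variables into $n/d^2$ disjoint piles of $d^2$ variables each, and index the variables of each pile by $\mathbb{F}_d\times\mathbb{F}_d$, where $\mathbb{F}_d$ is the finite field of order $d$. In each pile, for every $(a,b)\in\mathbb{F}_d^2$ let $S_{a,b}=\{(x,ax+b):x\in\mathbb{F}_d\}$ (a set of $d$ variables of that pile). Let $f:\{0,1\}^n\to\{0,1\}$ be any function whose $\mathrm{GF}(2)$ polynomial representation has degree $d$ and whose degree-$d$ monomials are exactly the $n$ monomials $\prod_{v\in S_{a,b}}x_v$ (over all piles and all $(a,b)\in\mathbb{F}_d^2$). Then $\|\hat f\|_0\ge 2^n-1$, regardless of the monomials of degree less than $d$.
   Context: For $h:\{0,1\}^n\to\mathbb{R}$ and $S\subseteq[n]$, $\hat h(S)=2^{ -n}\sum_{x}h(x)(-1)^{\sum_{i\in S}x_i}$; $\|\hat h\|_0$ is the number of $S$ with $\hat h(S)\ne0$. -}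

module Defs where

open import Level using (0ℓ)
open import Data.Bool using (Bool; true; false; _∧_; _∨_; _xor_; not; if_then_else_)
open import Data.Nat as ℕ using (ℕ; zero; suc)
open import Data.Nat.Primality using (Prime)
open import Data.Fin using (Fin)
open import Data.Vec using (Vec; []; _∷_; zipWith; foldr)
open import Data.List as List using (List; []; _∷_; _++_; filter; length)
open import Data.Integer as ℤ using (ℤ)
open import Data.Rational as ℚ using (ℚ; ½; 1ℚ; 0ℚ)
open import Data.Product using (∃; _×_; _,_)
open import Relation.Nullary using (¬_; ¬?)
open import Relation.Binary.PropositionalEquality using (_≡_)
open import Algebra.Core using (Op₁; Op₂)
open import Algebra.Structures using (IsCommutativeRing)
open import Function.Bundles using (_↔_)

OddPrimePower : ℕ → Set
OddPrimePower d = ∃ λ p → ∃ λ k → Prime p × ¬ (p ≡ 2) × (k ℕ.≥ 1) × (d ≡ p ℕ.^ k)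

record FiniteField (d : ℕ) : Set₁ where
  infixl 6 _+_
  infixl 7 _*_
  field
    Carrier : Set
    _+_ _*_ : Op₂ Carrier
    -_ : Op₁ Carrier
    0# 1# : Carrier
    isCommutativeRing : IsCommutativeRing _≡_ _+_ _*_ -_ 0# 1#
    0≢1 : ¬ (0# ≡ 1#)
    inverse : ∀ x → ¬ (x ≡ 0#) → ∃ λ y → x * y ≡ 1#
    card : Carrier ↔ Fin d

-- The Boolean cube {0,1}^n, listed without repetition.
-- Points x are vectors of bits; subsets S ⊆ [n] are their indicator vectors.
cube : (n : ℕ) → List (Vec Bool n)
cube zero = [] ∷ []
cube (suc n) = List.map (false ∷_) (cube n) ++ List.map (true ∷_) (cube n)

parity : ∀ {n} → Vec Bool n → Vec Bool n → Bool
parity S x = foldr _ _xor_ false (zipWith _∧_ S x)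

χ : ∀ {n} → Vec Bool n → Vec Bool n → ℤ
χ S x = if parity S x then ℤ.-[1+ 0 ] else ℤ.+ 1

bit : Bool → ℤ
bit true = ℤ.+ 1
bit false = ℤ.+ 0

halfPow : ℕ → ℚ
halfPow zero = 1ℚ
halfPow (suc k) = ½ ℚ.* halfPow k

fourier : ∀ {n} → (Vec Bool n → ℤ) → Vec Bool n → ℚ
fourier {n} h S = (List.foldr ℤ._+_ (ℤ.+ 0) (List.map (λ x → h x ℤ.* χ S x) (cube n)) ℚ./ 1) ℚ.* halfPow n

sparsity : ∀ {n} → (Vec Bool n → ℤ) → ℕ
sparsity {n} h = length (filter (λ S → ¬? (fourier h S ℚ.≟ 0ℚ)) (cube n))

monomial : ∀ {n} → Vec Bool n → Vec Bool n → Bool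
monomial T x = foldr _ _∧_ true (zipWith (λ t b → not t ∨ b) T x)

-- evaluation of the GF(2) multilinear polynomial with coefficient vector c at x:
-- ⊕_{T} c(T) ∏_{i∈T} x_i
evalGF2 : ∀ {n} → (Vec Bool n → Bool) → Vec Bool n → Bool
evalGF2 {n} c x = List.foldr _xor_ false (List.map (λ T → c T ∧ monomial T x) (cube n))

module Submission where

-- Fix S ⊆ [n], write χ_S(x) = (−1)^{S·x} and let M list the monomials of f
-- together with the singletons of S, so that (−1)^{f(x) ⊕ S·x} = (−1)^{M(x)}.
-- As f is {0,1}-valued,  2 ∑ₓ f(x)χ_S(x) = ∑ₓ χ_S(x) − ∑ₓ (−1)^{M(x)},  and the
-- first sum is 0 or 2ⁿ.  Expanding (−1)^{M(x)} = ∏_{T∈M} (1 − 2[T ⊆ x]) by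
-- inclusion–exclusion and counting powers of 2 shows, for deg M ≤ d and n = k d,
--   ∑ₓ (−1)^{M(x)} ≡ 2ᵏ · #(exact covers of [n] by degree-d monomials of M)
--                                                        (mod 2^{k+1}).
-- The degree-d monomials are the lines of the m piles 𝔽_d × 𝔽_d; a partition of
-- a pile into lines is a parallel class, so there are dᵐ exact covers, an odd
-- number.  Since n ≥ k + 1, ∑ₓ (−1)^{M(x)} is then neither 0 nor 2ⁿ modulo
-- 2^{k+1}, so f̂(S) ≠ 0 for all 2ⁿ sets S.

open import Defs using (FiniteField)
open import Data.Bool using (Bool; true)
open import Data.Nat using (ℕ; suc)
import Data.Nat
open import Data.Fin using (Fin)
open import Data.Fin.Subset using (∣_∣)
open import Data.Vec using (Vec)
open import Data.Product using (_×_)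
open import Relation.Binary.PropositionalEquality using (_≡_)
open import Function.Bundles using (_↔_; _⇔_)

module CubeSums where

  open import Defs
  open import Data.Bool using (Bool; true; false; _∧_; _∨_; _xor_; not; if_then_else_)
  open import Data.Nat as ℕ using (ℕ; zero; suc; _∸_; _^_)
  import Data.Nat.Properties as ℕP
  open import Data.Integer using (ℤ; +_; -[1+_]; _+_; _*_; _-_; -_)
  import Data.Integer.Properties as ℤP
  open import Data.Vec using (Vec; []; _∷_)
  open import Data.List as List using (List; []; _∷_; _++_)
  open import Data.Fin.Subset using (∣_∣; _∪_; ⊥)
  import Data.Fin.Subset.Properties as SP
  open import Relation.Binary.PropositionalEquality
  open import Data.Integer.Solver using (module +-*-Solver)
  open +-*-Solver

  -- ∑_{x ∈ xs} h x;  the numerator of `fourier` is literally such a sum over `cube n`.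
  sumOver : {A : Set} → List A → (A → ℤ) → ℤ
  sumOver xs h = List.foldr _+_ (+ 0) (List.map h xs)

  sumCube : ∀ {n} → (Vec Bool n → ℤ) → ℤ
  sumCube {n} h = sumOver (cube n) h

  sumOver-++ : {A : Set} (xs ys : List A) (h : A → ℤ) →
    sumOver (xs ++ ys) h ≡ sumOver xs h + sumOver ys h
  sumOver-++ [] ys h = sym (ℤP.+-identityˡ _)
  sumOver-++ (x ∷ xs) ys h =
    trans (cong (_+_ (h x)) (sumOver-++ xs ys h)) (sym (ℤP.+-assoc (h x) _ _))

  sumOver-map : {A B : Set} (xs : List A) (g : A → B) (h : B → ℤ) →
    sumOver (List.map g xs) h ≡ sumOver xs (λ x → h (g x))
  sumOver-map [] g h = refl
  sumOver-map (x ∷ xs) g h = cong (_+_ (h (g x))) (sumOver-map xs g h)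

  sumOver-cong : {A : Set} (xs : List A) {f g : A → ℤ} → (∀ x → f x ≡ g x) →
    sumOver xs f ≡ sumOver xs g
  sumOver-cong [] e = refl
  sumOver-cong (x ∷ xs) e = cong₂ _+_ (e x) (sumOver-cong xs e)

  sumOver-zero : {A : Set} (xs : List A) → sumOver xs (λ _ → + 0) ≡ + 0
  sumOver-zero [] = refl
  sumOver-zero (x ∷ xs) = trans (ℤP.+-identityˡ _) (sumOver-zero xs)

  -- Linearity in the form needed for the two-term recurrences below.
  sumOver-linear : {A : Set} (xs : List A) (f g : A → ℤ) (z : ℤ) →
    sumOver xs (λ x → f x - z * g x) ≡ sumOver xs f - z * sumOver xs g
  sumOver-linear [] f g z = solve 1 (λ z → con (+ 0) := con (+ 0) :- z :* con (+ 0)) refl z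
  sumOver-linear (x ∷ xs) f g z =
    trans (cong (_+_ (f x - z * g x)) (sumOver-linear xs f g z))
      (solve 5 (λ a b z c d → (a :- z :* b) :+ (c :- z :* d) := (a :+ c) :- z :* (b :+ d))
         refl (f x) (g x) z (sumOver xs f) (sumOver xs g))

  sumOver-scale : {A : Set} (xs : List A) (f : A → ℤ) (z : ℤ) →
    sumOver xs (λ x → z * f x) ≡ z * sumOver xs f
  sumOver-scale [] f z = sym (ℤP.*-zeroʳ z)
  sumOver-scale (x ∷ xs) f z =
    trans (cong (_+_ (z * f x)) (sumOver-scale xs f z)) (sym (ℤP.*-distribˡ-+ z (f x) (sumOver xs f)))

  sumOver-neg : {A : Set} (xs : List A) (f : A → ℤ) → sumOver xs (λ x → - f x) ≡ - sumOver xs f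
  sumOver-neg [] f = refl
  sumOver-neg (x ∷ xs) f =
    trans (cong (_+_ (- f x)) (sumOver-neg xs f)) (sym (ℤP.neg-distrib-+ (f x) (sumOver xs f)))

  sumCube-suc : ∀ {n} (h : Vec Bool (suc n) → ℤ) →
    sumCube h ≡ sumCube (λ x → h (false ∷ x)) + sumCube (λ x → h (true ∷ x))
  sumCube-suc {n} h = trans (sumOver-++ (List.map (false ∷_) (cube n)) _ h)
    (cong₂ _+_ (sumOver-map (cube n) (false ∷_) h) (sumOver-map (cube n) (true ∷_) h))

  sign : Bool → ℤ
  sign b = if b then -[1+ 0 ] else + 1

  pow2 : ℕ → ℤ
  pow2 e = + (2 ^ e)

  pow2-suc : ∀ e → pow2 (suc e) ≡ + 2 * pow2 e
  pow2-suc e = ℤP.pos-* 2 (2 ^ e)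

  pow2-+ : ∀ a b → pow2 (a ℕ.+ b) ≡ pow2 a * pow2 b
  pow2-+ a b = trans (cong +_ (ℕP.^-distribˡ-+-* 2 a b)) (ℤP.pos-* (2 ^ a) (2 ^ b))

  monomial-∪ : ∀ {n} (U T x : Vec Bool n) → monomial (U ∪ T) x ≡ monomial U x ∧ monomial T x
  monomial-∪ [] [] [] = refl
  monomial-∪ (u ∷ U) (t ∷ T) (b ∷ x) rewrite monomial-∪ U T x = lemma u t b (monomial U x) (monomial T x)
    where
    lemma : ∀ u t b p q → (not (u ∨ t) ∨ b) ∧ (p ∧ q) ≡ ((not u ∨ b) ∧ p) ∧ ((not t ∨ b) ∧ q)
    lemma false false b     p     q = refl
    lemma false true  false false q = refl
    lemma false true  false true  q = refl
    lemma false true  true  p     q = refl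
    lemma true  t     false p     q = refl
    lemma true  false true  p     q = refl
    lemma true  true  true  p     q = refl

  monomial-⊥ : ∀ {n} (x : Vec Bool n) → monomial ⊥ x ≡ true
  monomial-⊥ [] = refl
  monomial-⊥ (b ∷ x) = monomial-⊥ x

  sumCube-monomial : ∀ {n} (U : Vec Bool n) → sumCube (λ x → bit (monomial U x)) ≡ pow2 (n ∸ ∣ U ∣)
  sumCube-monomial {zero} [] = refl
  sumCube-monomial {suc n} (true ∷ U) = begin
      sumCube (λ x → bit (monomial (true ∷ U) x))
    ≡⟨ sumCube-suc {n} _ ⟩
      sumCube (λ x → bit (false ∧ monomial U x)) + sumCube (λ x → bit (true ∧ monomial U x))
    ≡⟨ cong₂ _+_ (sumOver-zero (cube n)) (sumCube-monomial U) ⟩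
      + 0 + pow2 (n ∸ ∣ U ∣)
    ≡⟨ ℤP.+-identityˡ _ ⟩
      pow2 (n ∸ ∣ U ∣) ∎
    where open ≡-Reasoning
  sumCube-monomial {suc n} (false ∷ U) = begin
      sumCube (λ x → bit (monomial (false ∷ U) x))
    ≡⟨ sumCube-suc {n} _ ⟩
      sumCube (λ x → bit (monomial U x)) + sumCube (λ x → bit (monomial U x))
    ≡⟨ cong₂ _+_ (sumCube-monomial U) (sumCube-monomial U) ⟩
      pow2 (n ∸ ∣ U ∣) + pow2 (n ∸ ∣ U ∣)
    ≡⟨ cong +_ (cong (2 ^ (n ∸ ∣ U ∣) ℕ.+_) (sym (ℕP.+-identityʳ _))) ⟩
      pow2 (suc (n ∸ ∣ U ∣))
    ≡⟨ cong pow2 (sym (ℕP.+-∸-assoc 1 (SP.∣p∣≤n U))) ⟩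
      pow2 (suc n ∸ ∣ U ∣) ∎
    where open ≡-Reasoning

  xorList : ∀ {n} → List (Vec Bool n) → Vec Bool n → Bool
  xorList M x = List.foldr _xor_ false (List.map (λ T → monomial T x) M)

  -- Inclusion–exclusion:  (−1)^{t ⊕ r} = (−1)^r − 2 [t] (−1)^r  gives the recurrence
  -- incExc (T ∷ M) U = incExc M U − 2 incExc M (U ∪ T), with base case 2^{n − |U|}.
  incExc : ∀ {n} → List (Vec Bool n) → Vec Bool n → ℤ
  incExc {n} [] U = pow2 (n ∸ ∣ U ∣)
  incExc (T ∷ M) U = incExc M U - + 2 * incExc M (U ∪ T)

  sign-xor : (u t r : Bool) → bit u * sign (t xor r) ≡ bit u * sign r - + 2 * (bit (u ∧ t) * sign r)
  sign-xor false t     r     = refl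
  sign-xor true  false false = refl
  sign-xor true  false true  = refl
  sign-xor true  true  false = refl
  sign-xor true  true  true  = refl

  incExc-sum : ∀ {n} (M : List (Vec Bool n)) (U : Vec Bool n) →
    incExc M U ≡ sumCube (λ x → bit (monomial U x) * sign (xorList M x))
  incExc-sum {n} [] U =
    sym (trans (sumOver-cong (cube n) (λ x → ℤP.*-identityʳ _)) (sumCube-monomial U))
  incExc-sum {n} (T ∷ M) U = begin
      incExc M U - + 2 * incExc M (U ∪ T)
    ≡⟨ cong₂ (λ a b → a - + 2 * b) (incExc-sum M U) (incExc-sum M (U ∪ T)) ⟩
      sumCube (λ x → term U x) - + 2 * sumCube (λ x → term (U ∪ T) x)
    ≡⟨ sym (sumOver-linear (cube n) _ _ (+ 2)) ⟩
      sumCube (λ x → term U x - + 2 * term (U ∪ T) x)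
    ≡⟨ sumOver-cong (cube n) split ⟩
      sumCube (λ x → bit (monomial U x) * sign (xorList (T ∷ M) x)) ∎
    where
    open ≡-Reasoning
    term : Vec Bool n → Vec Bool n → ℤ
    term V x = bit (monomial V x) * sign (xorList M x)
    split : ∀ x → term U x - + 2 * term (U ∪ T) x ≡ bit (monomial U x) * sign (xorList (T ∷ M) x)
    split x = trans (cong (λ w → term U x - + 2 * (bit w * sign (xorList M x))) (monomial-∪ U T x))
                    (sym (sign-xor (monomial U x) (monomial T x) (xorList M x)))

  incExc-⊥ : ∀ {n} (M : List (Vec Bool n)) → incExc M ⊥ ≡ sumCube (λ x → sign (xorList M x))
  incExc-⊥ {n} M = trans (incExc-sum M ⊥)
    (sumOver-cong (cube n) (λ x → trans (cong (λ w → bit w * sign (xorList M x)) (monomial-⊥ x))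
                                        (ℤP.*-identityˡ _)))

module SubsetSize where

  open import Defs
  open import Data.Bool using (Bool; true; false)
  open import Data.Nat using (suc; _+_; _≤_; s≤s; z≤n)
  open import Data.Nat.Properties using (≤-trans; ≤-reflexive; +-suc; m≤n⇒m≤1+n)
  open import Data.Vec using (Vec; []; _∷_)
  open import Data.Fin.Subset using (∣_∣; _∪_; ∁)
  open import Relation.Binary.PropositionalEquality

  ∣∪∣≤ : ∀ {n} (U T : Vec Bool n) → ∣ U ∪ T ∣ ≤ ∣ U ∣ + ∣ T ∣
  ∣∪∣≤ [] [] = z≤n
  ∣∪∣≤ (false ∷ U) (false ∷ T) = ∣∪∣≤ U T
  ∣∪∣≤ (false ∷ U) (true ∷ T) = ≤-trans (s≤s (∣∪∣≤ U T)) (≤-reflexive (sym (+-suc ∣ U ∣ ∣ T ∣)))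
  ∣∪∣≤ (true ∷ U) (false ∷ T) = s≤s (∣∪∣≤ U T)
  ∣∪∣≤ (true ∷ U) (true ∷ T) =
    s≤s (≤-trans (m≤n⇒m≤1+n (∣∪∣≤ U T)) (≤-reflexive (sym (+-suc ∣ U ∣ ∣ T ∣))))

  -- Disjoint union (T ⊆ ∁ U, i.e. the monomial of T is 1 at ∁ U) is additive ...
  ∣∪∣-disjoint : ∀ {n} (U T : Vec Bool n) → monomial T (∁ U) ≡ true → ∣ U ∪ T ∣ ≡ ∣ U ∣ + ∣ T ∣
  ∣∪∣-disjoint [] [] _ = refl
  ∣∪∣-disjoint (false ∷ U) (false ∷ T) e = ∣∪∣-disjoint U T e
  ∣∪∣-disjoint (false ∷ U) (true ∷ T) e = trans (cong suc (∣∪∣-disjoint U T e)) (sym (+-suc ∣ U ∣ ∣ T ∣))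
  ∣∪∣-disjoint (true ∷ U) (false ∷ T) e = cong suc (∣∪∣-disjoint U T e)
  ∣∪∣-disjoint (true ∷ U) (true ∷ T) ()

  ∣∪∣-overlap : ∀ {n} (U T : Vec Bool n) → monomial T (∁ U) ≡ false → suc ∣ U ∪ T ∣ ≤ ∣ U ∣ + ∣ T ∣
  ∣∪∣-overlap [] [] ()
  ∣∪∣-overlap (false ∷ U) (false ∷ T) e = ∣∪∣-overlap U T e
  ∣∪∣-overlap (false ∷ U) (true ∷ T) e =
    ≤-trans (s≤s (∣∪∣-overlap U T e)) (≤-reflexive (sym (+-suc ∣ U ∣ ∣ T ∣)))
  ∣∪∣-overlap (true ∷ U) (false ∷ T) e = s≤s (∣∪∣-overlap U T e)
  ∣∪∣-overlap (true ∷ U) (true ∷ T) e =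
    s≤s (≤-trans (s≤s (∣∪∣≤ U T)) (≤-reflexive (sym (+-suc ∣ U ∣ ∣ T ∣))))


module TwoAdic where

  open import Defs
  open CubeSums
  open SubsetSize
  open import Data.Bool using (Bool)
  open import Data.Nat as ℕ using (ℕ; zero; suc; _∸_; _≤_; s≤s)
  open import Data.Nat.Properties as ℕP using (≤-trans; ≤-reflexive)
  open import Data.Integer using (ℤ; +_; _+_; _*_; _-_)
  import Data.Integer.Properties as ℤP
  open import Data.Vec using (Vec)
  open import Data.List using (List; []; _∷_)
  open import Data.List.Relation.Unary.All using (All; []; _∷_)
  open import Data.Fin.Subset using (∣_∣; _∪_)
  import Data.Fin.Subset.Properties as SP
  open import Data.Product using (∃; _×_; _,_)
  open import Relation.Nullary using (¬_; yes; no)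
  open import Relation.Binary.PropositionalEquality
  open import Data.Integer.Solver using (module +-*-Solver)
  open +-*-Solver

  CongruentMod : ℤ → ℤ → ℤ → Set
  CongruentMod q a b = ∃ λ t → a ≡ b + t * q

  exponent-gap : ∀ {d k j u e} → 2 ≤ d → u ℕ.+ e ≡ k ℕ.* d → u ≤ d ℕ.* j →
                 ¬ (j ≡ k × e ≡ 0) → suc k ≤ j ℕ.+ e
  exponent-gap {d} {k} {j} {u} {e} 2≤d u+e≡kd u≤dj notTop with k ℕ.<? j
  ... | yes k<j = ≤-trans k<j (ℕP.m≤m+n j e)
  ... | no k≮j with ℕP.m≤n⇒∃[o]m+o≡n (ℕP.≮⇒≥ k≮j)
  ...   | r , refl = gap r refl rd≤e
    where
    open ℕP.≤-Reasoning
    -- k = j + r, so e must make up r * d.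
    rd≤e : r ℕ.* d ≤ e
    rd≤e = ℕP.+-cancelˡ-≤ (j ℕ.* d) _ _ (begin
      j ℕ.* d ℕ.+ r ℕ.* d ≡⟨ sym (ℕP.*-distribʳ-+ d j r) ⟩
      (j ℕ.+ r) ℕ.* d     ≡⟨ sym u+e≡kd ⟩
      u ℕ.+ e             ≤⟨ ℕP.+-monoˡ-≤ e (≤-trans u≤dj (≤-reflexive (ℕP.*-comm d j))) ⟩
      j ℕ.* d ℕ.+ e       ∎)
    gap : ∀ r' → r' ≡ r → r' ℕ.* d ≤ e → suc (j ℕ.+ r') ≤ j ℕ.+ e
    gap zero 0≡r _ = begin
      suc (j ℕ.+ 0)  ≡⟨ cong suc (ℕP.+-identityʳ j) ⟩
      suc j          ≡⟨ ℕP.+-comm 1 j ⟩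
      j ℕ.+ 1        ≤⟨ ℕP.+-monoʳ-≤ j (ℕP.n≢0⇒n>0 e≢0) ⟩
      j ℕ.+ e        ∎
      where
      -- here k = j, so e ≠ 0
      e≢0 : ¬ e ≡ 0
      e≢0 e≡0 = notTop (trans (sym (ℕP.+-identityʳ j)) (cong (j ℕ.+_) 0≡r) , e≡0)
    gap (suc r') _ r'd≤e = begin
      suc (j ℕ.+ suc r')    ≡⟨ sym (ℕP.+-suc j (suc r')) ⟩
      j ℕ.+ suc (suc r')    ≤⟨ ℕP.+-monoʳ-≤ j (s≤s (s≤s (ℕP.m≤m*n r' 2))) ⟩
      j ℕ.+ suc r' ℕ.* 2    ≤⟨ ℕP.+-monoʳ-≤ j (ℕP.*-monoʳ-≤ (suc r') 2≤d) ⟩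
      j ℕ.+ suc r' ℕ.* d    ≤⟨ ℕP.+-monoʳ-≤ j r'd≤e ⟩
      j ℕ.+ e               ∎

  module Schedule (n k d : ℕ) (n≡kd : n ≡ k ℕ.* d) (2≤d : 2 ≤ d) where

    -- fullChains M U j counts the sub-lists T₁, …, T_r of M with r = k − j whose
    -- union with U is all of [n]; it is the 2-adic leading part of incExc M U.
    fullChains : List (Vec Bool n) → Vec Bool n → ℕ → ℕ
    fullChains [] U j with j ℕ.≟ k | ∣ U ∣ ℕ.≟ n
    ... | yes _ | yes _ = 1
    ... | yes _ | no _ = 0
    ... | no _ | _ = 0
    fullChains (T ∷ M) U j = fullChains M U j ℕ.+ fullChains M (U ∪ T) (suc j)

    ∪-invariant : ∀ (U T : Vec Bool n) {j} → ∣ U ∣ ≤ d ℕ.* j → ∣ T ∣ ≤ d → ∣ U ∪ T ∣ ≤ d ℕ.* suc j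
    ∪-invariant U T {j} U≤ T≤ = ≤-trans (∣∪∣≤ U T) (≤-trans (ℕP.+-mono-≤ U≤ T≤)
      (≤-reflexive (trans (ℕP.+-comm (d ℕ.* j) d) (sym (ℕP.*-suc d j)))))

    base-vanishes : ∀ U j → ∣ U ∣ ≤ d ℕ.* j → ¬ (j ≡ k × n ∸ ∣ U ∣ ≡ 0) →
      CongruentMod (pow2 (suc k)) (pow2 j * pow2 (n ∸ ∣ U ∣)) (pow2 k * + 0)
    base-vanishes U j U≤ notTop
      with ℕP.m≤n⇒∃[o]m+o≡n (exponent-gap 2≤d (trans (ℕP.m+[n∸m]≡n (SP.∣p∣≤n U)) n≡kd) U≤ notTop)
    ... | r , eq = pow2 r , (begin
        pow2 j * pow2 (n ∸ ∣ U ∣)  ≡⟨ sym (pow2-+ j _) ⟩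
        pow2 (j ℕ.+ (n ∸ ∣ U ∣))   ≡⟨ cong pow2 (sym eq) ⟩
        pow2 (suc k ℕ.+ r)         ≡⟨ pow2-+ (suc k) r ⟩
        pow2 (suc k) * pow2 r      ≡⟨ solve 3 (λ a b c → b :* c := a :* con (+ 0) :+ c :* b) refl
                                        (pow2 k) (pow2 (suc k)) (pow2 r) ⟩
        pow2 k * + 0 + pow2 r * pow2 (suc k) ∎)
      where open ≡-Reasoning

    incExc-mod-base : ∀ U j → ∣ U ∣ ≤ d ℕ.* j →
      CongruentMod (pow2 (suc k)) (pow2 j * pow2 (n ∸ ∣ U ∣)) (pow2 k * + fullChains [] U j)
    incExc-mod-base U j U≤ with j ℕ.≟ k | ∣ U ∣ ℕ.≟ n
    ... | yes refl | yes U≡n = + 0 , (begin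
          pow2 j * pow2 (n ∸ ∣ U ∣) ≡⟨ cong (λ w → pow2 j * pow2 (n ∸ w)) U≡n ⟩
          pow2 j * pow2 (n ∸ n)     ≡⟨ cong (λ w → pow2 j * pow2 w) (ℕP.n∸n≡0 n) ⟩
          pow2 j * + 1              ≡⟨ solve 2 (λ a b → a :* con (+ 1) := a :* con (+ 1) :+ con (+ 0) :* b)
                                         refl (pow2 j) (pow2 (suc j)) ⟩
          pow2 j * + 1 + + 0 * pow2 (suc j) ∎)
      where open ≡-Reasoning
    ... | yes _ | no U≢n = base-vanishes U j U≤ λ (_ , e) →
            U≢n (ℕP.≤-antisym (SP.∣p∣≤n U) (ℕP.m∸n≡0⇒m≤n e))
    ... | no j≢k | _ = base-vanishes U j U≤ λ (j≡k , _) → j≢k j≡k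

    -- The estimate itself, by induction along the recurrence of incExc:
    -- the term 2 incExc M (U ∪ T) advances the schedule from j to j + 1.
    incExc-mod : ∀ (M : List (Vec Bool n)) → All (λ T → ∣ T ∣ ≤ d) M → ∀ U j → ∣ U ∣ ≤ d ℕ.* j →
      CongruentMod (pow2 (suc k)) (pow2 j * incExc M U) (pow2 k * + fullChains M U j)
    incExc-mod [] _ U j U≤ = incExc-mod-base U j U≤
    incExc-mod (T ∷ M) (T≤ ∷ M≤) U j U≤
      with incExc-mod M M≤ U j U≤ | incExc-mod M M≤ (U ∪ T) (suc j) (∪-invariant U T U≤ T≤)
    ... | q₁ , e₁ | q₂ , e₂ = q₁ - q₂ - + C₂ , (begin
        pow2 j * (incExc M U - + 2 * incExc M (U ∪ T))
      ≡⟨ solve 3 (λ p a b → p :* (a :- con (+ 2) :* b) := p :* a :- (con (+ 2) :* p) :* b)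
           refl (pow2 j) (incExc M U) (incExc M (U ∪ T)) ⟩
        pow2 j * incExc M U - (+ 2 * pow2 j) * incExc M (U ∪ T)
      ≡⟨ cong₂ (λ a b → a - b * incExc M (U ∪ T)) e₁ (sym (pow2-suc j)) ⟩
        (pow2 k * + C₁ + q₁ * pow2 (suc k)) - pow2 (suc j) * incExc M (U ∪ T)
      ≡⟨ cong₂ (λ a b → (pow2 k * + C₁ + q₁ * a) - b) (pow2-suc k) e₂ ⟩
        (pow2 k * + C₁ + q₁ * (+ 2 * pow2 k)) - (pow2 k * + C₂ + q₂ * pow2 (suc k))
      ≡⟨ cong (λ a → (pow2 k * + C₁ + q₁ * (+ 2 * pow2 k)) - (pow2 k * + C₂ + q₂ * a)) (pow2-suc k) ⟩
        (pow2 k * + C₁ + q₁ * (+ 2 * pow2 k)) - (pow2 k * + C₂ + q₂ * (+ 2 * pow2 k))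
      ≡⟨ solve 5 (λ p c₁ c₂ q₁ q₂ → (p :* c₁ :+ q₁ :* (con (+ 2) :* p)) :- (p :* c₂ :+ q₂ :* (con (+ 2) :* p))
                   := p :* (c₁ :+ c₂) :+ (q₁ :- q₂ :- c₂) :* (con (+ 2) :* p)) refl (pow2 k) (+ C₁) (+ C₂) q₁ q₂ ⟩
        pow2 k * (+ C₁ + + C₂) + (q₁ - q₂ - + C₂) * (+ 2 * pow2 k)
      ≡⟨ cong₂ (λ a b → pow2 k * a + (q₁ - q₂ - + C₂) * b) (sym (ℤP.pos-+ C₁ C₂)) (sym (pow2-suc k)) ⟩
        pow2 k * + (C₁ ℕ.+ C₂) + (q₁ - q₂ - + C₂) * pow2 (suc k) ∎)
      where
      open ≡-Reasoning
      C₁ = fullChains M U j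
      C₂ = fullChains M (U ∪ T) (suc j)

module ChainsAsCovers where

  open import Defs
  open SubsetSize
  open import Data.Bool as B using (Bool; true; false; not; if_then_else_)
  open import Data.Nat as ℕ using (ℕ; suc; _∸_; _≤_; _<_)
  open import Data.Nat.Properties as ℕP using (≤-trans; ≤-reflexive)
  open import Data.Vec using (Vec; []; _∷_)
  open import Data.List using (List; []; _∷_; filterᵇ)
  open import Data.List.Relation.Unary.All as All using (All; []; _∷_)
  open import Data.List.Relation.Binary.Permutation.Propositional using (_↭_; refl; prep; swap; trans)
  open import Data.Fin.Subset using (∣_∣; _∪_; _∩_; ∁)
  import Data.Fin.Subset.Properties as SP
  open import Data.Empty using (⊥-elim)
  open import Relation.Nullary using (yes; no)
  open import Relation.Binary.PropositionalEquality hiding (trans)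
  import Relation.Binary.PropositionalEquality as Eq
  open import Algebra.Properties.CommutativeSemigroup ℕP.+-commutativeSemigroup
    using () renaming (interchange to +-interchange)

  -- exactCovers M R: the number of sub-lists of M whose members partition R.
  exactCovers : ∀ {n} → List (Vec Bool n) → Vec Bool n → ℕ
  exactCovers [] R with ∣ R ∣ ℕ.≟ 0
  ... | yes _ = 1
  ... | no _ = 0
  exactCovers (T ∷ M) R = exactCovers M R ℕ.+ (if monomial T R then exactCovers M (R ∩ ∁ T) else 0)

  -- De Morgan: covering ∁ (U ∪ T) means covering ∁ U with T removed.
  ∁-∪ : ∀ {n} (U T : Vec Bool n) → ∁ (U ∪ T) ≡ ∁ U ∩ ∁ T
  ∁-∪ [] [] = refl
  ∁-∪ (false ∷ U) (t ∷ T) = cong (not t ∷_) (∁-∪ U T)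
  ∁-∪ (true ∷ U) (t ∷ T) = cong (false ∷_) (∁-∪ U T)

  module Schedule (n k d : ℕ) (n≡kd : n ≡ k ℕ.* d) (2≤d : 2 ≤ d) where

    open TwoAdic.Schedule n k d n≡kd 2≤d using (fullChains; ∪-invariant)

    d*suc : ∀ j → d ℕ.* j ℕ.+ d ≡ d ℕ.* suc j
    d*suc j = Eq.trans (ℕP.+-comm (d ℕ.* j) d) (sym (ℕP.*-suc d j))

    fullChains-behind : ∀ (M : List (Vec Bool n)) → All (λ T → ∣ T ∣ ≤ d) M →
      ∀ U j → ∣ U ∣ < d ℕ.* j → fullChains M U j ≡ 0
    fullChains-behind [] _ U j U< with j ℕ.≟ k | ∣ U ∣ ℕ.≟ n
    ... | yes refl | yes U≡n = ⊥-elim (ℕP.<-irrefl (Eq.trans U≡n (Eq.trans n≡kd (ℕP.*-comm j d))) U<)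
    ... | yes _ | no _ = refl
    ... | no _ | _ = refl
    fullChains-behind (T ∷ M) (T≤ ∷ M≤) U j U< = cong₂ ℕ._+_ (fullChains-behind M M≤ U j U<)
      (fullChains-behind M M≤ (U ∪ T) (suc j) (ℕP.≤-<-trans (∣∪∣≤ U T)
        (ℕP.<-≤-trans (ℕP.+-monoˡ-< ∣ T ∣ U<)
          (≤-trans (ℕP.+-monoʳ-≤ (d ℕ.* j) T≤) (≤-reflexive (d*suc j))))))

    isTop : Vec Bool n → Bool
    isTop T = ∣ T ∣ ℕ.≡ᵇ d

    fullChains-topDegree : ∀ (M : List (Vec Bool n)) → All (λ T → ∣ T ∣ ≤ d) M →
      ∀ U j → ∣ U ∣ ≤ d ℕ.* j → fullChains M U j ≡ fullChains (filterᵇ isTop M) U j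
    fullChains-topDegree [] _ U j U≤ = refl
    fullChains-topDegree (T ∷ M) (T≤ ∷ M≤) U j U≤ with isTop T in top
    ... | true = cong₂ ℕ._+_ (fullChains-topDegree M M≤ U j U≤)
          (fullChains-topDegree M M≤ (U ∪ T) (suc j) (∪-invariant U T U≤ T≤))
    ... | false = Eq.trans (cong₂ ℕ._+_ (fullChains-topDegree M M≤ U j U≤)
          (fullChains-behind M M≤ (U ∪ T) (suc j) (ℕP.≤-<-trans (∣∪∣≤ U T)
            (ℕP.<-≤-trans (ℕP.+-monoʳ-< ∣ U ∣ T<d)
              (≤-trans (ℕP.+-monoˡ-≤ d U≤) (≤-reflexive (d*suc j)))))))
          (ℕP.+-identityʳ _)
      where
      T<d : ∣ T ∣ < d
      T<d = ℕP.≤∧≢⇒< T≤ (λ e → subst B.T top (ℕP.≡⇒≡ᵇ ∣ T ∣ d e))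

    fullChains-↭ : ∀ {M M' : List (Vec Bool n)} → M ↭ M' → ∀ U j → fullChains M U j ≡ fullChains M' U j
    fullChains-↭ refl U j = refl
    fullChains-↭ (prep x p) U j = cong₂ ℕ._+_ (fullChains-↭ p U j) (fullChains-↭ p (U ∪ x) (suc j))
    fullChains-↭ (trans p q) U j = Eq.trans (fullChains-↭ p U j) (fullChains-↭ q U j)
    fullChains-↭ {x ∷ y ∷ xs} {.y ∷ .x ∷ ys} (swap .x .y p) U j = begin
        (fullChains xs U j ℕ.+ fullChains xs (U ∪ y) (suc j))
          ℕ.+ (fullChains xs (U ∪ x) (suc j) ℕ.+ fullChains xs ((U ∪ x) ∪ y) (suc (suc j)))
      ≡⟨ cong₂ ℕ._+_ (cong₂ ℕ._+_ (fullChains-↭ p U j) (fullChains-↭ p (U ∪ y) (suc j)))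
           (cong₂ ℕ._+_ (fullChains-↭ p (U ∪ x) (suc j))
             (Eq.trans (cong (λ W → fullChains xs W (suc (suc j))) ∪-swap) (fullChains-↭ p ((U ∪ y) ∪ x) (suc (suc j))))) ⟩
        (a ℕ.+ b) ℕ.+ (c ℕ.+ e)
      ≡⟨ +-interchange a b c e ⟩
        (a ℕ.+ c) ℕ.+ (b ℕ.+ e) ∎
      where
      open ≡-Reasoning
      a = fullChains ys U j
      b = fullChains ys (U ∪ y) (suc j)
      c = fullChains ys (U ∪ x) (suc j)
      e = fullChains ys ((U ∪ y) ∪ x) (suc (suc j))
      ∪-swap : (U ∪ x) ∪ y ≡ (U ∪ y) ∪ x
      ∪-swap = Eq.trans (SP.∪-assoc U x y)
        (Eq.trans (cong (U ∪_) (SP.∪-comm x y)) (sym (SP.∪-assoc U y x)))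

    fullChains≡exactCovers : ∀ (M : List (Vec Bool n)) → All (λ T → ∣ T ∣ ≡ d) M →
      ∀ U j → ∣ U ∣ ≡ d ℕ.* j → fullChains M U j ≡ exactCovers M (∁ U)
    fullChains≡exactCovers [] _ U j U≡ with j ℕ.≟ k | ∣ U ∣ ℕ.≟ n | ∣ ∁ U ∣ ℕ.≟ 0
    ... | yes _ | yes _ | yes _ = refl
    ... | yes _ | yes U≡n | no ∁U≢0 =
      ⊥-elim (∁U≢0 (Eq.trans (SP.∣∁p∣≡n∸∣p∣ U) (Eq.trans (cong (n ∸_) U≡n) (ℕP.n∸n≡0 n))))
    ... | yes refl | no U≢n | _ = ⊥-elim (U≢n (Eq.trans U≡ (Eq.trans (ℕP.*-comm d j) (sym n≡kd))))
    ... | no _ | _ | no _ = refl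
    ... | no j≢k | _ | yes ∁U≡0 =
      ⊥-elim (j≢k (ℕP.*-cancelˡ-≡ j k d ⦃ d≢0 ⦄ (Eq.trans (sym U≡) (Eq.trans U≡n (Eq.trans n≡kd (ℕP.*-comm k d))))))
      where
      d≢0 : ℕ.NonZero d
      d≢0 = ℕ.>-nonZero (ℕP.<-trans (ℕ.s≤s ℕ.z≤n) 2≤d)
      U≡n : ∣ U ∣ ≡ n
      U≡n = ℕP.≤-antisym (SP.∣p∣≤n U) (ℕP.m∸n≡0⇒m≤n (Eq.trans (sym (SP.∣∁p∣≡n∸∣p∣ U)) ∁U≡0))
    fullChains≡exactCovers (T ∷ M) (T≡ ∷ M≡) U j U≡ with monomial T (∁ U) in disjoint
    ... | true = cong₂ ℕ._+_ (fullChains≡exactCovers M M≡ U j U≡)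
          (Eq.trans (fullChains≡exactCovers M M≡ (U ∪ T) (suc j)
                      (Eq.trans (∣∪∣-disjoint U T disjoint) (Eq.trans (cong₂ ℕ._+_ U≡ T≡) (d*suc j))))
                    (cong (exactCovers M) (∁-∪ U T)))
    ... | false = cong₂ ℕ._+_ (fullChains≡exactCovers M M≡ U j U≡)
          (fullChains-behind M (All.map ≤-reflexive M≡) (U ∪ T) (suc j)
            (ℕP.<-≤-trans (∣∪∣-overlap U T disjoint) (≤-reflexive (Eq.trans (cong₂ ℕ._+_ U≡ T≡) (d*suc j)))))

-- Exact covers by families made of "classes": a class is a list of pairwise
-- disjoint nonempty subsets, and every later subset that meets one member of a
-- class meets all of them.  Then an exact cover uses either no member of a class
-- or all of them, which gives a product formula for exactCovers.
module ClassCovers where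

  open import Defs
  open ChainsAsCovers using (exactCovers)
  open import Data.Bool using (Bool; true; false; _∧_; _∨_; not; if_then_else_)
  open import Data.Bool.Properties using (∧-zeroʳ; ¬-not)
  open import Data.Nat as ℕ using (ℕ; zero; suc)
  import Data.Nat.Properties as ℕP
  open import Data.Fin using (Fin; zero; suc)
  open import Data.Vec using (Vec; []; _∷_; lookup)
  open import Data.Vec.Relation.Binary.Pointwise.Extensional using (ext; Pointwise-≡⇒≡)
  open import Data.List as List using (List; []; _∷_; _++_; concat; length)
  import Data.List.Properties as LP
  open import Data.List.Relation.Unary.All as All using (All; []; _∷_)
  import Data.List.Relation.Unary.All.Properties as AllP
  open import Data.List.Relation.Unary.AllPairs using (AllPairs; []; _∷_)
  open import Data.List.Relation.Unary.Any using (here; there)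
  open import Data.List.Membership.Propositional using (_∈_)
  open import Data.Fin.Subset using (∣_∣; _∩_; ∁)
  open import Data.Product using (∃; ∃₂; _×_; _,_)
  open import Data.Unit using (⊤)
  open import Relation.Nullary using (¬_; yes; no; contradiction)
  open import Relation.Binary.PropositionalEquality

  infix 4 _∋_ _⊑_

  _∋_ : ∀ {n} → Vec Bool n → Fin n → Set
  S ∋ i = lookup S i ≡ true

  _⊑_ : ∀ {n} → Vec Bool n → Vec Bool n → Set
  a ⊑ b = ∀ i → a ∋ i → b ∋ i

  Inhabited : ∀ {n} → Vec Bool n → Set
  Inhabited a = ∃ λ i → a ∋ i

  Meets : ∀ {n} → Vec Bool n → Vec Bool n → Set
  Meets T g = ∃ λ i → T ∋ i × g ∋ i

  Disjoint : ∀ {n} → Vec Bool n → Vec Bool n → Set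
  Disjoint a b = ∀ i → a ∋ i → lookup b i ≡ false

  -- T has a point outside R, so T cannot be used in an exact cover of R.
  Outside : ∀ {n} → Vec Bool n → Vec Bool n → Set
  Outside T R = ∃ λ i → T ∋ i × lookup R i ≡ false

  ≡-by-lookup : ∀ {n} {a b : Vec Bool n} → (∀ i → lookup a i ≡ lookup b i) → a ≡ b
  ≡-by-lookup h = Pointwise-≡⇒≡ (ext h)

  lookup-∖ : ∀ {n} (R T : Vec Bool n) i → lookup (R ∩ ∁ T) i ≡ lookup R i ∧ not (lookup T i)
  lookup-∖ (r ∷ R) (t ∷ T) zero = refl
  lookup-∖ (r ∷ R) (t ∷ T) (suc i) = lookup-∖ R T i

  monomial⇒⊑ : ∀ {n} {T R : Vec Bool n} → monomial T R ≡ true → T ⊑ R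
  monomial⇒⊑ {T = true ∷ T} {true ∷ R} _ zero _ = refl
  monomial⇒⊑ {T = true ∷ T} {false ∷ R} () zero _
  monomial⇒⊑ {T = false ∷ T} {r ∷ R} _ zero ()
  monomial⇒⊑ {T = t ∷ T} {r ∷ R} e (suc i) Ti = monomial⇒⊑ {T = T} {R} (tail-true t r e) i Ti
    where
    tail-true : ∀ t r → (not t ∨ r) ∧ monomial T R ≡ true → monomial T R ≡ true
    tail-true false r e = e
    tail-true true true e = e

  ⊑⇒monomial : ∀ {n} {T R : Vec Bool n} → T ⊑ R → monomial T R ≡ true
  ⊑⇒monomial {T = []} {[]} _ = refl
  ⊑⇒monomial {T = false ∷ T} {r ∷ R} h = ⊑⇒monomial {T = T} {R} (λ i → h (suc i))
  ⊑⇒monomial {T = true ∷ T} {r ∷ R} h rewrite h zero refl = ⊑⇒monomial {T = T} {R} (λ i → h (suc i))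

  Outside⇒monomial : ∀ {n} {T R : Vec Bool n} → Outside T R → monomial T R ≡ false
  Outside⇒monomial {T = true ∷ T} {false ∷ R} (zero , _ , _) = refl
  Outside⇒monomial {T = t ∷ T} {r ∷ R} (suc i , Ti , Ri)
    rewrite Outside⇒monomial {T = T} {R} (i , Ti , Ri) = ∧-zeroʳ _

  inhabited⇒size≢0 : ∀ {n} (R : Vec Bool n) {q} → R ∋ q → ¬ (∣ R ∣ ≡ 0)
  inhabited⇒size≢0 (true ∷ R) {zero} _ ()
  inhabited⇒size≢0 (true ∷ R) {suc q} _ ()
  inhabited⇒size≢0 (false ∷ R) {suc q} Rq = inhabited⇒size≢0 R Rq

  removeAll : ∀ {n} → Vec Bool n → List (Vec Bool n) → Vec Bool n
  removeAll R [] = R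
  removeAll R (g ∷ G) = removeAll (R ∩ ∁ g) G

  module _ {n : ℕ} where

    removeAll-⊑ : ∀ (G : List (Vec Bool n)) R → removeAll R G ⊑ R
    removeAll-⊑ [] R i e = e
    removeAll-⊑ (g ∷ G) R i e with lookup R i in Ri
    ... | true = refl
    ... | false = trans (sym (cong (λ b → b ∧ not (lookup g i)) Ri))
                        (trans (sym (lookup-∖ R g i)) (removeAll-⊑ G (R ∩ ∁ g) i e))

    removeAll-outside : ∀ (G : List (Vec Bool n)) R i → lookup R i ≡ false → lookup (removeAll R G) i ≡ false
    removeAll-outside G R i Ri = ¬-not λ e → contradiction (trans (sym (removeAll-⊑ G R i e)) Ri) λ ()

    removeAll-keeps : ∀ (G : List (Vec Bool n)) R i → R ∋ i → All (λ g → lookup g i ≡ false) G → removeAll R G ∋ i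
    removeAll-keeps [] R i Ri _ = Ri
    removeAll-keeps (g ∷ G) R i Ri (gi ∷ G∌i) =
      removeAll-keeps G (R ∩ ∁ g) i (trans (lookup-∖ R g i) (cong₂ (λ x y → x ∧ not y) Ri gi)) G∌i

    removeAll-removes : ∀ (G : List (Vec Bool n)) R i {g} → g ∈ G → g ∋ i → lookup (removeAll R G) i ≡ false
    removeAll-removes (g ∷ G) R i (here refl) gi = removeAll-outside G (R ∩ ∁ g) i
      (trans (lookup-∖ R g i) (trans (cong (λ y → lookup R i ∧ not y) gi) (∧-zeroʳ _)))
    removeAll-removes (g ∷ G) R i (there g∈G) gi = removeAll-removes G (R ∩ ∁ g) i g∈G gi

    exactCovers-blocked : ∀ (M : List (Vec Bool n)) R q → R ∋ q →
      All (λ T → T ∋ q → Outside T R) M → exactCovers M R ≡ 0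
    exactCovers-blocked [] R q Rq _ with ∣ R ∣ ℕ.≟ 0
    ... | yes R≡0 = contradiction R≡0 (inhabited⇒size≢0 R Rq)
    ... | no _ = refl
    exactCovers-blocked (T ∷ M) R q Rq (blockedT ∷ blocked) with monomial T R in T⊑R
    ... | false = trans (ℕP.+-identityʳ _) (exactCovers-blocked M R q Rq blocked)
    ... | true = cong₂ ℕ._+_ (exactCovers-blocked M R q Rq blocked)
                   (exactCovers-blocked M (R ∩ ∁ T) q R∖T∋q (All.map (λ {T'} → shrink {T'}) blocked))
      where
      T∌q : lookup T q ≡ false
      T∌q = ¬-not λ Tq → let (i , Ti , Ri) = blockedT Tq in
              contradiction (trans (sym Ri) (monomial⇒⊑ {T = T} {R} T⊑R i Ti)) λ ()
      R∖T∋q : (R ∩ ∁ T) ∋ q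
      R∖T∋q = trans (lookup-∖ R T q) (cong₂ (λ x y → x ∧ not y) Rq T∌q)
      shrink : ∀ {T'} → (T' ∋ q → Outside T' R) → T' ∋ q → Outside T' (R ∩ ∁ T)
      shrink out T'q with out T'q
      ... | i , T'i , Ri = i , T'i , trans (lookup-∖ R T i) (cong (λ x → x ∧ not (lookup T i)) Ri)

    exactCovers-skip : ∀ (G M : List (Vec Bool n)) R → All (λ g → Outside g R) G →
      exactCovers (G ++ M) R ≡ exactCovers M R
    exactCovers-skip [] M R _ = refl
    exactCovers-skip (g ∷ G) M R (out ∷ outs) =
      trans (cong (λ b → exactCovers (G ++ M) R ℕ.+ (if b then exactCovers (G ++ M) (R ∩ ∁ g) else 0))
                  (Outside⇒monomial {T = g} {R} out))
            (trans (ℕP.+-identityʳ _) (exactCovers-skip G M R outs))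

  Crosses : ∀ {n} → List (Vec Bool n) → Vec Bool n → Set
  Crosses C T = ∀ g g' → g ∈ C → g' ∈ C → Meets T g → Meets T g'

  module Class {n : ℕ} (C M : List (Vec Bool n)) (crossing : All (Crosses C) M) where

    exactCovers-take : ∀ (g : Vec Bool n) (M' : List (Vec Bool n)) R → g ⊑ R →
      exactCovers (g ∷ M') R ≡ exactCovers M' R ℕ.+ exactCovers M' (R ∩ ∁ g)
    exactCovers-take g M' R g⊑R =
      cong (λ b → exactCovers M' R ℕ.+ (if b then exactCovers M' (R ∩ ∁ g) else 0)) (⊑⇒monomial {T = g} {R} g⊑R)

    disjoint-sym : ∀ {a b : Vec Bool n} i → Disjoint a b → b ∋ i → lookup a i ≡ false
    disjoint-sym i a#b bi = ¬-not λ ai → contradiction (trans (sym (a#b i ai)) bi) λ ()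

    ⊑-∖ : ∀ (G : List (Vec Bool n)) (g R : Vec Bool n) → All (Disjoint g) G → All (_⊑ R) G →
      All (_⊑ R ∩ ∁ g) G
    ⊑-∖ [] g R _ _ = []
    ⊑-∖ (h ∷ G) g R (g#h ∷ g#G) (h⊑R ∷ G⊑R) =
      (λ i hi → trans (lookup-∖ R g i) (cong₂ (λ x y → x ∧ not y) (h⊑R i hi) (disjoint-sym {g} {h} i g#h hi)))
      ∷ ⊑-∖ G g R g#G G⊑R

    -- A point of a class member can only be covered by that member: once the members
    -- of the class in front of M are skipped, the cover of what remains fails.
    stuck : ∀ {g g₀ : Vec Bool n} R' q → g ∈ C → g₀ ∈ C → g ∋ q → R' ∋ q →
      Disjoint g₀ R' → exactCovers M R' ≡ 0
    stuck {g} {g₀} R' q g∈C g₀∈C gq R'q g₀#R' = exactCovers-blocked M R' q R'q (All.map (λ {T} → out {T}) crossing)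
      where
      out : ∀ {T} → Crosses C T → T ∋ q → Outside T R'
      out cross Tq with cross _ _ g∈C g₀∈C (q , Tq , gq)
      ... | i , Ti , g₀i = i , Ti , g₀#R' i g₀i

    -- Once a member g₀ of the class has been used, the remaining members of the class
    -- are forced.
    exactCovers-committed : ∀ (g : Vec Bool n) (G : List (Vec Bool n)) (R g₀ : Vec Bool n) →
      g₀ ∈ C → Disjoint g₀ R → All (_⊑ R) (g ∷ G) → All Inhabited (g ∷ G) →
      AllPairs Disjoint (g ∷ G) → All (_∈ C) (g ∷ G) →
      exactCovers ((g ∷ G) ++ M) R ≡ exactCovers M (removeAll R (g ∷ G))
    exactCovers-committed g [] R g₀ g₀∈C g₀#R (g⊑R ∷ _) ((q , gq) ∷ _) _ (g∈C ∷ _) =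
      trans (exactCovers-take g M R g⊑R)
        (cong (ℕ._+ exactCovers M (R ∩ ∁ g)) (stuck R q g∈C g₀∈C gq (g⊑R q gq) g₀#R))
    exactCovers-committed g (g' ∷ G) R g₀ g₀∈C g₀#R (g⊑R ∷ G⊑R) ((q , gq) ∷ inh) (g#G ∷ disj) (g∈C ∷ G∈C) =
      trans (exactCovers-take g ((g' ∷ G) ++ M) R g⊑R)
        (cong₂ ℕ._+_
          (trans (exactCovers-committed g' G R g₀ g₀∈C g₀#R G⊑R inh disj G∈C)
            (stuck (removeAll R (g' ∷ G)) q g∈C g₀∈C gq
              (removeAll-keeps (g' ∷ G) R q (g⊑R q gq) (All.map (λ g#h → g#h q gq) g#G))
              (λ i g₀i → removeAll-outside (g' ∷ G) R i (g₀#R i g₀i))))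
          (exactCovers-committed g' G (R ∩ ∁ g) g₀ g₀∈C
            (λ i g₀i → trans (lookup-∖ R g i) (cong (λ x → x ∧ not (lookup g i)) (g₀#R i g₀i)))
            (⊑-∖ (g' ∷ G) g R g#G G⊑R) inh disj G∈C))

    -- A class in front of M is used entirely or not at all.
    exactCovers-class : ∀ (g : Vec Bool n) (G : List (Vec Bool n)) (R : Vec Bool n) →
      All (_⊑ R) (g ∷ G) → All Inhabited (g ∷ G) → AllPairs Disjoint (g ∷ G) → All (_∈ C) (g ∷ G) →
      exactCovers ((g ∷ G) ++ M) R ≡ exactCovers M R ℕ.+ exactCovers M (removeAll R (g ∷ G))
    exactCovers-class g [] R (g⊑R ∷ _) _ _ _ = exactCovers-take g M R g⊑R
    exactCovers-class g (g' ∷ G) R (g⊑R ∷ G⊑R) ((q , gq) ∷ inh) (g#G ∷ disj) (g∈C ∷ G∈C) =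
      trans (exactCovers-take g ((g' ∷ G) ++ M) R g⊑R)
        (trans (cong₂ ℕ._+_
                 (trans (exactCovers-class g' G R G⊑R inh disj G∈C)
                   (cong (exactCovers M R ℕ.+_)
                     (stuck (removeAll R (g' ∷ G)) q g∈C (All.head G∈C) gq
                       (removeAll-keeps (g' ∷ G) R q (g⊑R q gq) (All.map (λ g#h → g#h q gq) g#G))
                       (λ i g'i → removeAll-removes (g' ∷ G) R i (here refl) g'i))))
                 (exactCovers-committed g' G (R ∩ ∁ g) g g∈C
                   (λ i gi → trans (lookup-∖ R g i) (trans (cong (λ y → lookup R i ∧ not y) gi) (∧-zeroʳ _)))
                   (⊑-∖ (g' ∷ G) g R g#G G⊑R) inh disj G∈C))
          (cong (ℕ._+ exactCovers M (removeAll R (g ∷ g' ∷ G))) (ℕP.+-identityʳ _)))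

  CrossesAll : ∀ {n} → List (List (Vec Bool n)) → List (Vec Bool n) → Set
  CrossesAll [] Rest = ⊤
  CrossesAll (C ∷ Cs) Rest = All (Crosses C) (concat Cs ++ Rest) × CrossesAll Cs Rest

  module _ {n : ℕ} where

    IsClassOf : Vec Bool n → Vec Bool n → List (Vec Bool n) → Set
    IsClassOf R R' C = (∃₂ λ g G → C ≡ g ∷ G) × All (_⊑ R) C × All Inhabited C ×
                       AllPairs Disjoint C × removeAll R C ≡ R'

    classes-outside : ∀ (Cs : List (List (Vec Bool n))) R R' → All (IsClassOf R R') Cs →
      All (λ g → Outside g R') (concat Cs)
    classes-outside [] R R' _ = []
    classes-outside (C ∷ Cs) R R' ((_ , _ , inh , _ , R∖C≡R') ∷ rest) =
      AllP.++⁺ (All.tabulate member-outside) (classes-outside Cs R R' rest)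
      where
      member-outside : ∀ {g} → g ∈ C → Outside g R'
      member-outside {g} g∈C with All.lookup inh g∈C
      ... | i , gi = i , gi , trans (sym (cong (λ w → lookup w i) R∖C≡R')) (removeAll-removes C R i g∈C gi)

    -- Several classes, each splitting R into itself and R', in front of Rest:
    -- an exact cover of R uses no class, or exactly one class and then covers R'.
    exactCovers-classes : ∀ (Cs : List (List (Vec Bool n))) (Rest : List (Vec Bool n)) R R' →
      All (IsClassOf R R') Cs → CrossesAll Cs Rest →
      exactCovers (concat Cs ++ Rest) R ≡ exactCovers Rest R ℕ.+ length Cs ℕ.* exactCovers Rest R'
    exactCovers-classes [] Rest R R' _ _ = sym (ℕP.+-identityʳ _)
    exactCovers-classes (C ∷ Cs) Rest R R' (((g , G , refl) , C⊑R , inh , disj , R∖C≡R') ∷ classes) (crossing , crossings) =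
      begin
        exactCovers ((C ++ concat Cs) ++ Rest) R
      ≡⟨ cong (λ w → exactCovers w R) (LP.++-assoc C (concat Cs) Rest) ⟩
        exactCovers (C ++ (concat Cs ++ Rest)) R
      ≡⟨ Class.exactCovers-class C (concat Cs ++ Rest) crossing g G R C⊑R inh disj (All.tabulate (λ g∈C → g∈C)) ⟩
        exactCovers (concat Cs ++ Rest) R ℕ.+ exactCovers (concat Cs ++ Rest) (removeAll R C)
      ≡⟨ cong₂ ℕ._+_ (exactCovers-classes Cs Rest R R' classes crossings)
           (trans (cong (exactCovers (concat Cs ++ Rest)) R∖C≡R')
                  (exactCovers-skip (concat Cs) Rest R' (classes-outside Cs R R' classes))) ⟩
        (a ℕ.+ length Cs ℕ.* b) ℕ.+ b
      ≡⟨ ℕP.+-assoc a (length Cs ℕ.* b) b ⟩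
        a ℕ.+ (length Cs ℕ.* b ℕ.+ b)
      ≡⟨ cong (a ℕ.+_) (ℕP.+-comm (length Cs ℕ.* b) b) ⟩
        a ℕ.+ suc (length Cs) ℕ.* b ∎
      where
      open ≡-Reasoning
      a = exactCovers Rest R
      b = exactCovers Rest R'

module FieldFacts {d : ℕ} (F : FiniteField d) where

  open FiniteField F public
  open import Algebra.Bundles using (CommutativeRing)
  open import Data.Fin as Fin using (Fin)
  open import Data.Product using (∃; _,_)
  open import Relation.Nullary using (¬_; Dec; map′)
  open import Relation.Binary.PropositionalEquality
  open import Function.Bundles using (Inverse)

  -- The field as a commutative ring, to use the library's group lemmas.
  commutativeRing : CommutativeRing _ _
  commutativeRing = record { isCommutativeRing = isCommutativeRing }

  open CommutativeRing commutativeRing public using (_-_)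
  open CommutativeRing commutativeRing
    using (+-group; +-identityˡ; zeroʳ; *-identityʳ; *-assoc; *-comm; distribʳ; *-identityˡ)
  open import Algebra.Properties.Group +-group
    using (∙-cancelˡ; ∙-cancelʳ; \\-leftDividesˡ; //-rightDividesˡ; x∙y⁻¹≈ε⇒x≈y)

  toFin : Carrier → Fin d
  toFin = Inverse.to card

  fromFin : Fin d → Carrier
  fromFin = Inverse.from card

  fromFin-toFin : ∀ x → fromFin (toFin x) ≡ x
  fromFin-toFin x = Inverse.inverseʳ card refl

  toFin-fromFin : ∀ y → toFin (fromFin y) ≡ y
  toFin-fromFin y = Inverse.inverseˡ card refl

  infix 4 _≟_
  _≟_ : (x y : Carrier) → Dec (x ≡ y)
  x ≟ y = map′ (λ e → trans (sym (fromFin-toFin x)) (trans (cong fromFin e) (fromFin-toFin y)))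
               (cong toFin) (toFin x Fin.≟ toFin y)

  line-at-0 : ∀ a b → a * 0# + b ≡ b
  line-at-0 a b = trans (cong (_+ b) (zeroʳ a)) (+-identityˡ b)

  line-through : ∀ a x y → y ≡ a * x + (- (a * x) + y)
  line-through a x y = sym (\\-leftDividesˡ (a * x) y)

  -- Parallel lines agreeing at one point coincide.
  intercept-unique : ∀ c b b' → c + b ≡ c + b' → b ≡ b'
  intercept-unique = ∙-cancelˡ

  slope-unique : ∀ a b a' → a * 1# + b ≡ a' * 1# + b → a ≡ a'
  slope-unique a b a' e =
    trans (sym (*-identityʳ a)) (trans (∙-cancelʳ b (a * 1#) (a' * 1#) e) (*-identityʳ a'))

  lines-meet : ∀ a b a' b' → ¬ (a ≡ a') → ∃ λ x → a * x + b ≡ a' * x + b'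
  lines-meet a b a' b' a≢a' with inverse (a - a') (λ e → a≢a' (x∙y⁻¹≈ε⇒x≈y a a' e))
  ... | v , [a-a']v≡1 = x , (begin
      a * x + b                  ≡⟨ cong (λ z → z * x + b) (sym (//-rightDividesˡ a' a)) ⟩
      ((a - a') + a') * x + b    ≡⟨ cong (_+ b) (distribʳ x (a - a') a') ⟩
      ((a - a') * x + a' * x) + b ≡⟨ cong (λ z → (z + a' * x) + b) scaled ⟩
      ((b' - b) + a' * x) + b    ≡⟨ cong (_+ b) (+-comm (b' - b) (a' * x)) ⟩
      (a' * x + (b' - b)) + b    ≡⟨ +-assoc (a' * x) (b' - b) b ⟩
      a' * x + ((b' - b) + b)    ≡⟨ cong (a' * x +_) (//-rightDividesˡ b b') ⟩
      a' * x + b'                ∎)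
    where
    open ≡-Reasoning
    open CommutativeRing commutativeRing using (+-comm; +-assoc)
    x = (b' - b) * v
    scaled : (a - a') * x ≡ b' - b
    scaled = begin
      (a - a') * ((b' - b) * v) ≡⟨ cong ((a - a') *_) (*-comm (b' - b) v) ⟩
      (a - a') * (v * (b' - b)) ≡⟨ sym (*-assoc (a - a') v (b' - b)) ⟩
      ((a - a') * v) * (b' - b) ≡⟨ cong (_* (b' - b)) [a-a']v≡1 ⟩
      1# * (b' - b)             ≡⟨ *-identityˡ (b' - b) ⟩
      b' - b                    ∎

-- Affine lines in the piles: the variables are indexed by Fin n ≅ Fin m × 𝔽 × 𝔽
-- (pile, x, y), and the line (p, a, b) is {(p, x, a x + b) : x ∈ 𝔽}.
module Lines {d : ℕ} (F : FiniteField d) (m n : ℕ)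
  (pile : (Fin m × FiniteField.Carrier F × FiniteField.Carrier F) ↔ Fin n) where

  open FieldFacts F public
  open ClassCovers using (_∋_; ≡-by-lookup)
  open import Data.Bool using (Bool; true)
  open import Data.Bool.Properties using (⇔→≡)
  open import Data.Fin as Fin using (Fin)
  open import Data.Vec using (Vec; lookup; tabulate)
  open import Data.Vec.Properties using (lookup∘tabulate)
  open import Data.Product using (∃; _×_; _,_; proj₁; proj₂)
  open import Relation.Nullary using (Dec; does; yes; no; _×-dec_)
  open import Relation.Nullary.Decidable using (dec-true)
  open import Relation.Binary.PropositionalEquality
  open import Function.Bundles using (_↔_; Inverse; _⇔_; mk⇔; Equivalence)

  coords : Fin n → Fin m × Carrier × Carrier
  coords = Inverse.from pile

  point : Fin m → Carrier → Carrier → Fin n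
  point p x y = Inverse.to pile (p , x , y)

  coords-point : ∀ p x y → coords (point p x y) ≡ (p , x , y)
  coords-point p x y = Inverse.inverseʳ pile refl

  pileOf : Fin n → Fin m
  pileOf i = proj₁ (coords i)

  xOf yOf : Fin n → Carrier
  xOf i = proj₁ (proj₂ (coords i))
  yOf i = proj₂ (proj₂ (coords i))

  OnLine : Fin m → Carrier → Carrier → Fin n → Set
  OnLine p a b i = pileOf i ≡ p × yOf i ≡ a * xOf i + b

  IsLine : Vec Bool n → Set
  IsLine T = ∃ λ p → ∃ λ a → ∃ λ b → ∀ i → lookup T i ≡ true ⇔ OnLine p a b i

  onLine? : ∀ p a b i → Dec (OnLine p a b i)
  onLine? p a b i = pileOf i Fin.≟ p ×-dec yOf i ≟ a * xOf i + b

  line : Fin m → Carrier → Carrier → Vec Bool n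
  line p a b = tabulate (λ i → does (onLine? p a b i))

  does⇒ : ∀ {A : Set} (a? : Dec A) → does a? ≡ true → A
  does⇒ (yes a) _ = a
  does⇒ (no _) ()

  line-∋⇒ : ∀ {p a b i} → line p a b ∋ i → OnLine p a b i
  line-∋⇒ {p} {a} {b} {i} e = does⇒ (onLine? p a b i) (trans (sym (lookup∘tabulate _ i)) e)

  ⇒line-∋ : ∀ {p a b i} → OnLine p a b i → line p a b ∋ i
  ⇒line-∋ {p} {a} {b} {i} on = trans (lookup∘tabulate _ i) (dec-true (onLine? p a b i) on)

  line-pile : ∀ {p a b i} → line p a b ∋ i → pileOf i ≡ p
  line-pile e = proj₁ (line-∋⇒ e)

  line-isLine : ∀ p a b → IsLine (line p a b)
  line-isLine p a b = p , a , b , λ i → mk⇔ line-∋⇒ ⇒line-∋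

  isLine⇒≡line : ∀ {T} → (L : IsLine T) → T ≡ line (proj₁ L) (proj₁ (proj₂ L)) (proj₁ (proj₂ (proj₂ L)))
  isLine⇒≡line (p , a , b , T∋⇔) = ≡-by-lookup λ i →
    ⇔→≡ (mk⇔ (λ Ti → ⇒line-∋ (Equivalence.to (T∋⇔ i) Ti)) (λ li → Equivalence.from (T∋⇔ i) (line-∋⇒ li)))

  point-on-line : ∀ p a b x → line p a b ∋ point p x (a * x + b)
  point-on-line p a b x = ⇒line-∋
    ( cong proj₁ (coords-point p x (a * x + b))
    , trans (cong (λ t → proj₂ (proj₂ t)) (coords-point p x (a * x + b)))
            (cong (λ t → a * proj₁ (proj₂ t) + b) (sym (coords-point p x (a * x + b)))) )

  -- A line determines its pile, slope and intercept (look at x = 0 and x = 1).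
  line-injective : ∀ {p a b p' a' b'} → line p a b ≡ line p' a' b' → p ≡ p' × a ≡ a' × b ≡ b'
  line-injective {p} {a} {b} {p'} {a'} {b'} e = p≡p' , a≡a' , b≡b'
    where
    on' : ∀ x → OnLine p' a' b' (point p x (a * x + b))
    on' x = line-∋⇒ (subst (_∋ point p x (a * x + b)) e (point-on-line p a b x))
    same-y : ∀ x → a * x + b ≡ a' * x + b'
    same-y x = trans (sym (cong (λ t → proj₂ (proj₂ t)) (coords-point p x (a * x + b))))
      (trans (proj₂ (on' x)) (cong (λ t → a' * proj₁ (proj₂ t) + b') (coords-point p x (a * x + b))))
    p≡p' : p ≡ p'
    p≡p' = trans (sym (cong proj₁ (coords-point p 0# (a * 0# + b)))) (proj₁ (on' 0#))
    b≡b' : b ≡ b'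
    b≡b' = trans (sym (line-at-0 a b)) (trans (same-y 0#) (line-at-0 a' b'))
    a≡a' : a ≡ a'
    a≡a' = slope-unique a b a' (trans (same-y 1#) (cong (a' * 1# +_) (sym b≡b')))

module ListFacts where

  open import Defs
  open import Data.Bool using (Bool; true; false; _∧_; if_then_else_)
  open import Data.Nat using (ℕ; zero; suc; _+_; _^_)
  import Data.Nat.Properties as ℕP
  open import Data.Fin as Fin using (Fin)
  import Data.Fin.Properties as FinP
  open import Data.Vec using (Vec; []; _∷_)
  import Data.Vec.Properties as VecP
  open import Data.List as List using (List; []; _∷_; _++_; concat; replicate; tabulate; filterᵇ; length)
  import Data.List.Properties as LP
  open import Data.List.Relation.Unary.All as All using (All; []; _∷_)
  open import Data.List.Relation.Unary.AllPairs as AllPairs using (AllPairs; []; _∷_)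
  import Data.List.Relation.Unary.AllPairs.Properties as AllPairsP
  import Data.List.Relation.Unary.All.Properties as AllP
  open import Data.List.Relation.Unary.Any using (here; there)
  open import Data.List.Membership.Propositional using (_∈_)
  open import Data.List.Membership.Propositional.Properties using (∈-++⁺ˡ; ∈-++⁺ʳ; ∈-map⁺; ∈-tabulate⁻)
  open import Data.List.Relation.Binary.Permutation.Propositional using (_↭_; ↭-refl; ↭-trans; ↭-sym; prep)
  open import Data.List.Relation.Binary.Permutation.Propositional.Properties using (++⁺; ++⁺ˡ; shifts)
  open import Relation.Nullary using (¬_)
  open import Data.Product using (_,_)
  open import Relation.Binary.PropositionalEquality

  countTrue : {A : Set} → (A → Bool) → List A → ℕ
  countTrue h [] = 0
  countTrue h (x ∷ xs) = if h x then suc (countTrue h xs) else countTrue h xs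

  countTrue-map : {A B : Set} (h : B → Bool) (f : A → B) (xs : List A) →
    countTrue h (List.map f xs) ≡ countTrue (λ x → h (f x)) xs
  countTrue-map h f [] = refl
  countTrue-map h f (x ∷ xs) with h (f x)
  ... | true = cong suc (countTrue-map h f xs)
  ... | false = countTrue-map h f xs

  countTrue-none : {A : Set} (h : A → Bool) (xs : List A) → (∀ {x} → x ∈ xs → h x ≡ false) → countTrue h xs ≡ 0
  countTrue-none h [] _ = refl
  countTrue-none h (x ∷ xs) none rewrite none (here refl) = countTrue-none h xs (λ x∈ → none (there x∈))

  countTrue-unique : {A : Set} (m : ℕ) (f : Fin m → A) (h : A → Bool) (j₀ : Fin m) →
    (∀ j → h (f j) ≡ true → j ≡ j₀) → h (f j₀) ≡ true → countTrue h (tabulate f) ≡ 1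
  countTrue-unique (suc m) f h Fin.zero only hj₀ rewrite hj₀ =
    cong suc (countTrue-none h (tabulate (λ j → f (Fin.suc j))) none)
    where
    none : ∀ {x} → x ∈ tabulate (λ j → f (Fin.suc j)) → h x ≡ false
    none x∈ with ∈-tabulate⁻ x∈
    ... | j , refl with h (f (Fin.suc j)) in hj
    ...   | false = refl
    ...   | true with only (Fin.suc j) hj
    ...     | ()
  countTrue-unique (suc m) f h (Fin.suc j₀) only hj₀ with h (f Fin.zero) in h0
  ... | true with only Fin.zero h0
  ...   | ()
  countTrue-unique (suc m) f h (Fin.suc j₀) only hj₀ | false =
    countTrue-unique m (λ j → f (Fin.suc j)) h j₀ (λ j hj → FinP.suc-injective (only (Fin.suc j) hj)) hj₀

  module _ {A : Set} where

    private
      filters : List (A → Bool) → List A → List A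
      filters Qs xs = concat (List.map (λ Q → filterᵇ Q xs) Qs)

      filters-[] : ∀ Qs → filters Qs [] ≡ []
      filters-[] [] = refl
      filters-[] (Q ∷ Qs) = filters-[] Qs

      filters-∷ : ∀ Qs x xs → filters Qs (x ∷ xs) ↭ replicate (countTrue (λ Q → Q x) Qs) x ++ filters Qs xs
      filters-∷ [] x xs = ↭-refl
      filters-∷ (Q ∷ Qs) x xs with Q x
      ... | true = prep x (↭-trans (++⁺ˡ (filterᵇ Q xs) (filters-∷ Qs x xs))
                                   (shifts (filterᵇ Q xs) (replicate (countTrue (λ Q → Q x) Qs) x)))
      ... | false = ↭-trans (++⁺ˡ (filterᵇ Q xs) (filters-∷ Qs x xs))
                            (shifts (filterᵇ Q xs) (replicate (countTrue (λ Q → Q x) Qs) x))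

    filter-↭-filters : ∀ (P : A → Bool) (Qs : List (A → Bool)) xs →
      (∀ x → countTrue (λ Q → Q x) Qs ≡ (if P x then 1 else 0)) →
      filterᵇ P xs ↭ concat (List.map (λ Q → filterᵇ Q xs) Qs)
    filter-↭-filters P Qs [] _ = ↭-sym (subst (_↭ []) (sym (filters-[] Qs)) ↭-refl)
    filter-↭-filters P Qs (x ∷ xs) partition with P x | partition x
    ... | true | once = ↭-sym (↭-trans (filters-∷ Qs x xs)
            (subst (λ k → replicate k x ++ filters Qs xs ↭ x ∷ filterᵇ P xs) (sym once)
              (prep x (↭-sym (filter-↭-filters P Qs xs partition)))))
    ... | false | never = ↭-sym (↭-trans (filters-∷ Qs x xs)
            (subst (λ k → replicate k x ++ filters Qs xs ↭ filterᵇ P xs) (sym never)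
              (↭-sym (filter-↭-filters P Qs xs partition))))

    filterᵇ-∧ : ∀ (p q : A → Bool) xs → filterᵇ q (filterᵇ p xs) ≡ filterᵇ (λ x → p x ∧ q x) xs
    filterᵇ-∧ p q [] = refl
    filterᵇ-∧ p q (x ∷ xs) with p x
    ... | false = filterᵇ-∧ p q xs
    ... | true with q x
    ...   | true = cong (x ∷_) (filterᵇ-∧ p q xs)
    ...   | false = filterᵇ-∧ p q xs

  AllPairs-restrict : {A : Set} {R S : A → A → Set} {P : A → Set} (xs : List A) →
    AllPairs R xs → All P xs → (∀ {x y} → P x → P y → R x y → S x y) → AllPairs S xs
  AllPairs-restrict [] _ _ _ = []
  AllPairs-restrict {R = R} {S} {P} (x ∷ xs) (Rx ∷ Rxs) (Px ∷ Pxs) strengthen =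
    All.zipWith (λ (Py , Rxy) → strengthen Px Py Rxy) (Pxs , Rx) ∷ AllPairs-restrict xs Rxs Pxs strengthen

  concatMap-↭ : {A B : Set} (f g : A → List B) (ys : List A) → (∀ y → f y ↭ g y) →
    concat (List.map f ys) ↭ concat (List.map g ys)
  concatMap-↭ f g [] _ = ↭-refl
  concatMap-↭ f g (y ∷ ys) f↭g = ++⁺ (f↭g y) (concatMap-↭ f g ys f↭g)

  ∈-cube : ∀ {n} (x : Vec Bool n) → x ∈ cube n
  ∈-cube [] = here refl
  ∈-cube {suc n} (false ∷ x) = ∈-++⁺ˡ (∈-map⁺ (false ∷_) (∈-cube x))
  ∈-cube {suc n} (true ∷ x) = ∈-++⁺ʳ (List.map (false ∷_) (cube n)) (∈-map⁺ (true ∷_) (∈-cube x))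

  cube-unique : ∀ n → AllPairs (λ x y → ¬ x ≡ y) (cube n)
  cube-unique zero = [] ∷ []
  cube-unique (suc n) = AllPairsP.++⁺ (cons-unique false) (cons-unique true)
    (AllP.map⁺ (All.tabulate (λ _ → AllP.map⁺ (All.tabulate (λ _ ())))))
    where
    cons-unique : ∀ b → AllPairs (λ x y → ¬ x ≡ y) (List.map (b ∷_) (cube n))
    cons-unique b = AllPairsP.map⁺ (AllPairs.map (λ x≢y e → x≢y (VecP.∷-injectiveʳ e)) (cube-unique n))

  length-cube : ∀ n → length (cube n) ≡ 2 ^ n
  length-cube zero = refl
  length-cube (suc n) = begin
      length (List.map (false ∷_) (cube n) ++ List.map (true ∷_) (cube n))
    ≡⟨ LP.length-++ (List.map (false ∷_) (cube n)) ⟩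
      length (List.map (false ∷_) (cube n)) + length (List.map (true ∷_) (cube n))
    ≡⟨ cong₂ _+_ (trans (LP.length-map _ (cube n)) (length-cube n)) (trans (LP.length-map _ (cube n)) (length-cube n)) ⟩
      2 ^ n + 2 ^ n
    ≡⟨ cong (2 ^ n +_) (sym (ℕP.+-identityʳ (2 ^ n))) ⟩
      2 ^ suc n ∎
    where open ≡-Reasoning

-- The configuration of the theorem: the degree-d monomials of c are exactly the
-- lines of the m piles.  Grouped by pile and then by slope they form classes in
-- the sense of ClassCovers; hence they have dᵐ exact covers of [n].
module LineConfiguration {d : ℕ} (F : FiniteField d) (m n : ℕ)
  (pile : (Fin m × FiniteField.Carrier F × FiniteField.Carrier F) ↔ Fin n)
  (c : Vec Bool n → Bool)
  (top⇔line : ∀ T → (c T ≡ true × ∣ T ∣ ≡ d) ⇔ Lines.IsLine F m n pile T) where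

  open import Defs using (cube)
  open Lines F m n pile
  open ClassCovers
  open ChainsAsCovers using (exactCovers)
  open ListFacts
  open import Data.Bool using (Bool; true; false; _∧_; not; if_then_else_)
  import Data.Bool as Bool
  open import Data.Bool.Properties as BoolP using (T-≡; ¬-not; ⇔→≡)
  open import Data.Nat as ℕ using (ℕ; _^_)
  import Data.Nat.Properties as ℕP
  open import Data.Fin as Fin using (Fin)
  import Data.Fin.Properties as FinP
  open import Data.Vec as Vec using (Vec; lookup)
  import Data.Vec.Properties as VecP
  open import Data.List as List using (List; []; _∷_; _++_; concat; tabulate; allFin; length; filterᵇ)
  import Data.List.Properties as LP
  open import Data.List.Relation.Unary.All as All using (All; []; _∷_)
  open import Data.List.Relation.Unary.AllPairs using (AllPairs; []; _∷_)
  import Data.List.Relation.Unary.AllPairs.Properties as AllPairsP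
  open import Data.List.Relation.Unary.Any using (here; there)
  open import Data.List.Membership.Propositional using (_∈_)
  open import Data.List.Membership.Propositional.Properties
    using (∈-tabulate⁺; ∈-map⁻; ∈-concat⁻′; ∈-++⁻; ∈-filter⁺; ∈-filter⁻; ∈-allFin)
  open import Data.List.Membership.DecPropositional (Fin._≟_ {m}) using (_∈?_)
  import Data.List.Relation.Unary.Unique.Propositional.Properties as UniqueP
  open import Data.List.Relation.Binary.Permutation.Propositional using (_↭_; ↭-trans)
  open import Data.Fin.Subset using (∣_∣; ∁; ⊥)
  import Data.Fin.Subset.Properties as SP
  open import Data.Product using (∃; ∃₂; _×_; _,_; proj₁; proj₂)
  open import Data.Sum using (inj₁; inj₂)
  import Data.Empty as Empty
  open import Relation.Nullary using (¬_; Dec; does; yes; no; contradiction)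
  open import Relation.Nullary.Decidable using (dec-true)
  open import Relation.Binary.PropositionalEquality
  open import Function.Bundles using (Equivalence; mk⇔)
  open import Function using (_∘_)

  elements : List Carrier
  elements = tabulate fromFin

  elements-unique : AllPairs (λ x y → ¬ x ≡ y) elements
  elements-unique = UniqueP.tabulate⁺ (λ {i} {j} e → trans (sym (toFin-fromFin i)) (trans (cong toFin e) (toFin-fromFin j)))

  lineOf? : ∀ p a T → Dec (∃ λ j → T ≡ line p a (fromFin j))
  lineOf? p a T = FinP.any? (λ j → VecP.≡-dec BoolP._≟_ T (line p a (fromFin j)))

  isLineOf : Fin m → Carrier → Vec Bool n → Bool
  isLineOf p a T = does (lineOf? p a T)

  isLineIn : Fin m → Vec Bool n → Bool
  isLineIn p T = does (FinP.any? (λ j → lineOf? p (fromFin j) T))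

  isLineOf⇒ : ∀ {p a T} → isLineOf p a T ≡ true → ∃ λ b → T ≡ line p a b
  isLineOf⇒ {p} {a} {T} e with does⇒ (lineOf? p a T) e
  ... | j , T≡ = fromFin j , T≡

  ⇒isLineOf : ∀ {p a b T} → T ≡ line p a b → isLineOf p a T ≡ true
  ⇒isLineOf {p} {a} {b} {T} T≡ =
    dec-true (lineOf? p a T) (toFin b , trans T≡ (cong (line p a) (sym (fromFin-toFin b))))

  isLineIn⇒ : ∀ {p T} → isLineIn p T ≡ true → ∃₂ λ a b → T ≡ line p a b
  isLineIn⇒ {p} {T} e with does⇒ (FinP.any? (λ j → lineOf? p (fromFin j) T)) e
  ... | j , j' , T≡ = fromFin j , fromFin j' , T≡

  ⇒isLineIn : ∀ {p a b T} → T ≡ line p a b → isLineIn p T ≡ true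
  ⇒isLineIn {p} {a} {b} {T} T≡ = dec-true (FinP.any? (λ j → lineOf? p (fromFin j) T))
    (toFin a , toFin b , trans T≡ (cong₂ (line p) (sym (fromFin-toFin a)) (sym (fromFin-toFin b))))

  topMonomial : Vec Bool n → Bool
  topMonomial T = c T ∧ (∣ T ∣ ℕ.≡ᵇ d)

  topMonomial⇒isLine : ∀ {T} → topMonomial T ≡ true → IsLine T
  topMonomial⇒isLine {T} e with c T in cT
  ... | true = Equivalence.to (top⇔line T) (cT , ℕP.≡ᵇ⇒≡ ∣ T ∣ d (Equivalence.from T-≡ e))

  isLine⇒topMonomial : ∀ {T} → IsLine T → topMonomial T ≡ true
  isLine⇒topMonomial {T} L with Equivalence.from (top⇔line T) L
  ... | cT , size rewrite cT = Equivalence.to T-≡ (ℕP.≡⇒≡ᵇ ∣ T ∣ d size)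

  line-size : ∀ p a b → ∣ line p a b ∣ ≡ d
  line-size p a b = proj₂ (Equivalence.from (top⇔line (line p a b)) (line-isLine p a b))

  count-piles : ∀ T → countTrue (λ Q → Q T) (List.map isLineIn (allFin m)) ≡ (if topMonomial T then 1 else 0)
  count-piles T with topMonomial T in top
  ... | true = trans (countTrue-map (λ Q → Q T) isLineIn (allFin m))
                     (countTrue-unique m (λ p → p) (λ p → isLineIn p T) p₀ only (⇒isLineIn (isLine⇒≡line L)))
    where
    L = topMonomial⇒isLine top
    p₀ = proj₁ L
    only : ∀ p → isLineIn p T ≡ true → p ≡ p₀
    only p e with isLineIn⇒ e
    ... | a , b , T≡ = proj₁ (line-injective (trans (sym T≡) (isLine⇒≡line L)))
  ... | false = trans (countTrue-map (λ Q → Q T) isLineIn (allFin m)) (countTrue-none (λ p → isLineIn p T) (allFin m) none)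
    where
    none : ∀ {p} → p ∈ allFin m → isLineIn p T ≡ false
    none {p} _ = ¬-not λ e → let (a , b , T≡) = isLineIn⇒ e in
      contradiction (trans (sym top) (isLine⇒topMonomial (subst IsLine (sym T≡) (line-isLine p a b)))) λ ()

  count-slopes : ∀ p T → countTrue (λ Q → Q T) (List.map (isLineOf p) elements) ≡ (if isLineIn p T then 1 else 0)
  count-slopes p T with isLineIn p T in inPile
  ... | true with isLineIn⇒ inPile
  ...   | a₀ , b₀ , T≡ = trans (countTrue-map (λ Q → Q T) (isLineOf p) elements)
          (countTrue-unique d fromFin (λ a → isLineOf p a T) (toFin a₀) only
            (subst (λ a → isLineOf p a T ≡ true) (sym (fromFin-toFin a₀)) (⇒isLineOf T≡)))
    where
    only : ∀ j → isLineOf p (fromFin j) T ≡ true → j ≡ toFin a₀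
    only j e with isLineOf⇒ e
    ... | b , T≡' = trans (sym (toFin-fromFin j)) (cong toFin (proj₁ (proj₂ (line-injective (trans (sym T≡') T≡)))))
  count-slopes p T | false = trans (countTrue-map (λ Q → Q T) (isLineOf p) elements)
                                   (countTrue-none (λ a → isLineOf p a T) elements none)
    where
    none : ∀ {a} → a ∈ elements → isLineOf p a T ≡ false
    none {a} _ = ¬-not λ e → let (b , T≡) = isLineOf⇒ e in
      contradiction (trans (sym inPile) (⇒isLineIn T≡)) λ ()

  parallelClass : Fin m → Carrier → List (Vec Bool n)
  parallelClass p a = filterᵇ (isLineOf p a) (cube n)

  pileLines : Fin m → List (Vec Bool n)
  pileLines p = concat (List.map (parallelClass p) elements)

  allLines : List (Vec Bool n)
  allLines = concat (List.map pileLines (allFin m))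

  topMonomials↭allLines : filterᵇ topMonomial (cube n) ↭ allLines
  topMonomials↭allLines = ↭-trans (filter-↭-filters topMonomial (List.map isLineIn (allFin m)) (cube n) count-piles)
    (subst (λ L → concat L ↭ allLines) (LP.map-∘ (allFin m))
      (concatMap-↭ (λ p → filterᵇ (isLineIn p) (cube n)) pileLines (allFin m)
        (λ p → subst (λ L → filterᵇ (isLineIn p) (cube n) ↭ concat L) (sym (LP.map-∘ elements))
                 (filter-↭-filters (isLineIn p) (List.map (isLineOf p) elements) (cube n) (count-slopes p)))))

  ∈-parallelClass⇒ : ∀ {p a T} → T ∈ parallelClass p a → ∃ λ b → T ≡ line p a b
  ∈-parallelClass⇒ {p} {a} T∈ = isLineOf⇒ (Equivalence.to T-≡ (proj₂ (∈-filter⁻ (Bool.T? ∘ isLineOf p a) {xs = cube n} T∈)))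

  line∈parallelClass : ∀ p a b → line p a b ∈ parallelClass p a
  line∈parallelClass p a b = ∈-filter⁺ (Bool.T? ∘ isLineOf p a) (∈-cube (line p a b)) (Equivalence.from T-≡ (⇒isLineOf refl))

  ∈-classes⇒ : ∀ {p T} as → T ∈ concat (List.map (parallelClass p) as) → ∃ λ a → a ∈ as × ∃ λ b → T ≡ line p a b
  ∈-classes⇒ as T∈ with ∈-concat⁻′ (List.map (parallelClass _) as) T∈
  ... | C , T∈C , C∈ with ∈-map⁻ _ C∈
  ...   | a , a∈ , refl = a , a∈ , ∈-parallelClass⇒ T∈C

  ∈-piles⇒ : ∀ {T} ps → T ∈ concat (List.map pileLines ps) → ∃ λ p → p ∈ ps × ∃₂ λ a b → T ≡ line p a b
  ∈-piles⇒ ps T∈ with ∈-concat⁻′ (List.map pileLines ps) T∈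
  ... | C , T∈C , C∈ with ∈-map⁻ _ C∈
  ...   | p , p∈ , refl with ∈-classes⇒ elements T∈C
  ...     | a , _ , b , T≡ = p , p∈ , a , b , T≡

  piles : List (Fin m) → Vec Bool n
  piles ps = Vec.tabulate (λ i → does (pileOf i ∈? ps))

  piles-∋⇒ : ∀ ps {i} → piles ps ∋ i → pileOf i ∈ ps
  piles-∋⇒ ps {i} e = does⇒ (pileOf i ∈? ps) (trans (sym (VecP.lookup∘tabulate _ i)) e)

  ⇒piles-∋ : ∀ ps {p i} → p ∈ ps → pileOf i ≡ p → piles ps ∋ i
  ⇒piles-∋ ps {p} {i} p∈ refl = trans (VecP.lookup∘tabulate _ i) (dec-true (pileOf i ∈? ps) p∈)

  -- One pile p in front of the piles ps: its d parallel classes are classes of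
  -- piles (p ∷ ps) splitting off piles ps, and the remaining lines cannot cover pile p.
  module OnePile (p : Fin m) (ps : List (Fin m)) (p∉ps : All (λ q → ¬ p ≡ q) ps) where
    R R' : Vec Bool n
    R = piles (p ∷ ps)
    R' = piles ps
    rest = concat (List.map pileLines ps)

    other-pile : ∀ {q i} → q ∈ ps → pileOf i ≡ p → pileOf i ≡ q → Empty.⊥
    other-pile q∈ ip iq = All.lookup p∉ps q∈ (trans (sym ip) iq)

-- The lines of slope a partition pile p: removing them from R leaves R'.
    removeAll-class : ∀ a → removeAll R (parallelClass p a) ≡ R'
    removeAll-class a = ≡-by-lookup λ i → ⇔→≡ (mk⇔ (to i) (from i))
      where
      to : ∀ i → removeAll R (parallelClass p a) ∋ i → R' ∋ i
      to i e with piles-∋⇒ (p ∷ ps) (removeAll-⊑ (parallelClass p a) R i e)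
      ... | there i∈ps = ⇒piles-∋ ps i∈ps refl
      ... | here ip = contradiction (trans (sym (removeAll-removes (parallelClass p a) R i
                          (line∈parallelClass p a b) (⇒line-∋ (ip , line-through a (xOf i) (yOf i))))) e) λ ()
        where b = - (a * xOf i) + yOf i
      from : ∀ i → R' ∋ i → removeAll R (parallelClass p a) ∋ i
      from i e = removeAll-keeps (parallelClass p a) R i (⇒piles-∋ (p ∷ ps) (there (piles-∋⇒ ps e)) refl)
        (All.tabulate λ g∈ → ¬-not λ gi → let (b , g≡) = ∈-parallelClass⇒ g∈ in
           other-pile (piles-∋⇒ ps e) (line-pile (subst (_∋ i) g≡ gi)) refl)

    class-disjoint : ∀ a {g g'} → (∃ λ b → g ≡ line p a b) → (∃ λ b → g' ≡ line p a b) → ¬ g ≡ g' → Disjoint g g'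
    class-disjoint a (b , refl) (b' , refl) g≢g' i gi = ¬-not λ g'i →
      g≢g' (cong (line p a) (intercept-unique (a * xOf i) b b' (trans (sym (proj₂ (line-∋⇒ gi))) (proj₂ (line-∋⇒ g'i)))))

    isClass : ∀ a → IsClassOf R R' (parallelClass p a)
    isClass a = nonempty (line∈parallelClass p a 0#)
              , All.tabulate (λ g∈ i gi → ⇒piles-∋ (p ∷ ps) (here refl) (line-pile (subst (_∋ i) (proj₂ (∈-parallelClass⇒ g∈)) gi)))
              , All.tabulate (λ g∈ → let (b , g≡) = ∈-parallelClass⇒ g∈ in
                   point p 0# (a * 0# + b) , subst (_∋ point p 0# (a * 0# + b)) (sym g≡) (point-on-line p a b 0#))
              , AllPairs-restrict (parallelClass p a) (AllPairsP.filter⁺ _ (cube-unique n))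
                  (All.tabulate ∈-parallelClass⇒) (class-disjoint a)
              , removeAll-class a
      where
      nonempty : ∀ {x} {xs : List (Vec Bool n)} → x ∈ xs → ∃₂ λ y ys → xs ≡ y ∷ ys
      nonempty {xs = y ∷ ys} _ = y , ys , refl

    -- A later line meeting one line of slope a meets all of them: it has a different
    -- slope and the same pile, as lines of other piles meet no line of pile p.
    crossing : ∀ as → AllPairs (λ x y → ¬ x ≡ y) as → CrossesAll (List.map (parallelClass p) as) rest
    crossing [] _ = _
    crossing (a ∷ as) (a∉as ∷ unique) = All.tabulate crosses , crossing as unique
      where
      crosses : ∀ {T} → T ∈ concat (List.map (parallelClass p) as) ++ rest → Crosses (parallelClass p a) T
      crosses {T} T∈ g g' g∈ g'∈ (j , Tj , gj) with ∈-++⁻ (concat (List.map (parallelClass p) as)) T∈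
      ... | inj₁ T∈classes with ∈-classes⇒ as T∈classes | ∈-parallelClass⇒ g'∈
      ...   | a' , a'∈ , b' , refl | b , refl with lines-meet a b a' b' (All.lookup a∉as a'∈)
      ...     | x , meet = point p x (a * x + b)
                         , subst (λ y → line p a' b' ∋ point p x y) (sym meet) (point-on-line p a' b' x)
                         , point-on-line p a b x
      crosses {T} T∈ g g' g∈ g'∈ (j , Tj , gj) | inj₂ T∈rest with ∈-piles⇒ ps T∈rest | ∈-parallelClass⇒ g∈
      ...   | q , q∈ , a' , b' , refl | b , refl = contradiction (line-pile gj) λ jp → other-pile q∈ jp (line-pile Tj)

    rest-blocked : exactCovers rest R ≡ 0
    rest-blocked = exactCovers-blocked rest R q (⇒piles-∋ (p ∷ ps) (here refl) q-pile) (All.tabulate blocked)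
      where
      q = point p 0# 0#
      q-pile : pileOf q ≡ p
      q-pile = cong proj₁ (coords-point p 0# 0#)
      blocked : ∀ {T} → T ∈ rest → T ∋ q → Outside T R
      blocked T∈ Tq with ∈-piles⇒ ps T∈
      ... | q' , q'∈ , a' , b' , refl = contradiction (line-pile Tq) (other-pile q'∈ q-pile)

    exactCovers-pile : exactCovers (pileLines p ++ rest) R ≡ d ℕ.* exactCovers rest R'
    exactCovers-pile = begin
        exactCovers (pileLines p ++ rest) R
      ≡⟨ exactCovers-classes (List.map (parallelClass p) elements) rest R R'
           (All.tabulate class∈) (crossing elements elements-unique) ⟩
        exactCovers rest R ℕ.+ length (List.map (parallelClass p) elements) ℕ.* exactCovers rest R'
      ≡⟨ cong₂ (λ a b → a ℕ.+ b ℕ.* exactCovers rest R') rest-blocked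
           (trans (LP.length-map (parallelClass p) elements) (LP.length-tabulate fromFin)) ⟩
        d ℕ.* exactCovers rest R' ∎
      where
      open ≡-Reasoning
      class∈ : ∀ {C} → C ∈ List.map (parallelClass p) elements → IsClassOf R R' C
      class∈ C∈ with ∈-map⁻ _ C∈
      ... | a , _ , refl = isClass a

  exactCovers-piles : ∀ ps → AllPairs (λ x y → ¬ x ≡ y) ps →
    exactCovers (concat (List.map pileLines ps)) (piles ps) ≡ d ^ length ps
  exactCovers-piles [] _ = empty
    where
    empty : exactCovers [] (piles []) ≡ 1
    empty with ∣ piles [] ∣ ℕ.≟ 0
    ... | yes _ = refl
    ... | no ≢0 = contradiction (trans (cong ∣_∣ (≡-by-lookup {a = piles []} {b = ⊥} (λ i → trans (VecP.lookup∘tabulate _ i)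
                                   (sym (VecP.lookup-replicate i false))))) (SP.∣⊥∣≡0 n)) ≢0
  exactCovers-piles (p ∷ ps) (p∉ps ∷ unique) =
    trans (OnePile.exactCovers-pile p ps p∉ps) (cong (d ℕ.*_) (exactCovers-piles ps unique))

  exactCovers-allLines : exactCovers allLines (∁ ⊥) ≡ d ^ m
  exactCovers-allLines = begin
      exactCovers allLines (∁ ⊥)
    ≡⟨ cong (exactCovers allLines) (≡-by-lookup λ i → trans (VecP.lookup-map i not ⊥)
         (trans (cong not (VecP.lookup-replicate i false)) (sym (⇒piles-∋ (allFin m) (∈-allFin (pileOf i)) refl)))) ⟩
      exactCovers allLines (piles (allFin m))
    ≡⟨ exactCovers-piles (allFin m) (UniqueP.allFin⁺ m) ⟩
      d ^ length (allFin m)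
    ≡⟨ cong (d ^_) (LP.length-tabulate {n = m} (λ (x : Fin m) → x)) ⟩
      d ^ m ∎
    where open ≡-Reasoning

  allLines-size : All (λ T → ∣ T ∣ ≡ d) allLines
  allLines-size = All.tabulate λ T∈ → let (p , _ , a , b , T≡) = ∈-piles⇒ (allFin m) T∈ in
    subst (λ T → ∣ T ∣ ≡ d) (sym T≡) (line-size p a b)

module FourierSide where

  open import Defs
  open CubeSums
  open import Data.Bool using (Bool; true; false; _∧_; _xor_; not; if_then_else_)
  import Data.Bool.Properties as BoolP
  open import Data.Nat as ℕ using (ℕ; zero; suc)
  import Data.Nat.Properties as ℕP
  open import Data.Integer using (ℤ; +_; _+_; _*_; _-_; -_)
  import Data.Integer.Properties as ℤP
  open import Data.Integer.GCD using (gcd)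
  open import Data.Rational as ℚ using (ℚ; ½; 0ℚ; ↥_)
  import Data.Rational.Properties as ℚP
  open import Data.Vec using (Vec; []; _∷_)
  open import Data.List as List using (List; []; _∷_; _++_; filterᵇ)
  open import Data.List.Relation.Unary.All using (All; []; _∷_)
  import Data.List.Relation.Unary.All.Properties as AllP
  open import Data.Fin.Subset using (∣_∣; ⊥)
  import Data.Fin.Subset.Properties as SP
  open import Data.Sum as Sum using (_⊎_; inj₁; inj₂)
  open import Relation.Nullary using (¬_)
  open import Relation.Binary.PropositionalEquality

  sign-not : ∀ b → sign (not b) ≡ - sign b
  sign-not true = refl
  sign-not false = refl

  characterSum : ∀ {n} (S : Vec Bool n) →
    sumCube (λ x → sign (parity S x)) ≡ + 0 ⊎ sumCube (λ x → sign (parity S x)) ≡ pow2 n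
  characterSum {zero} [] = inj₂ refl
  characterSum {suc n} (false ∷ S) with characterSum S
  ... | inj₁ e = inj₁ (trans (sumCube-suc {n} _) (cong₂ _+_ e e))
  ... | inj₂ e = inj₂ (trans (sumCube-suc {n} _)
          (trans (cong₂ _+_ e e) (cong +_ (cong (2 ℕ.^ n ℕ.+_) (sym (ℕP.+-identityʳ _))))))
  characterSum {suc n} (true ∷ S) = inj₁ (trans (sumCube-suc {n} _)
    (trans (cong (_+_ (sumCube (λ x → sign (parity S x))))
                 (trans (sumOver-cong (cube n) (λ x → sign-not (parity S x)))
                        (sumOver-neg (cube n) (λ x → sign (parity S x)))))
           (ℤP.+-inverseʳ (sumCube (λ x → sign (parity S x))))))

  xorList-++ : ∀ {n} (A B : List (Vec Bool n)) x → xorList (A ++ B) x ≡ xorList A x xor xorList B x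
  xorList-++ [] B x = refl
  xorList-++ (T ∷ A) B x =
    trans (cong (monomial T x xor_) (xorList-++ A B x)) (sym (BoolP.xor-assoc (monomial T x) _ _))

  evalGF2-monomials : ∀ {n} (c : Vec Bool n → Bool) x → evalGF2 c x ≡ xorList (filterᵇ c (cube n)) x
  evalGF2-monomials {n} c x = go (cube n)
    where
    go : ∀ xs → List.foldr _xor_ false (List.map (λ T → c T ∧ monomial T x) xs) ≡ xorList (filterᵇ c xs) x
    go [] = refl
    go (T ∷ xs) with c T
    ... | true = cong (monomial T x xor_) (go xs)
    ... | false = go xs

  singletons : ∀ {n} → Vec Bool n → List (Vec Bool n)
  singletons [] = []
  singletons (s ∷ S) = (if s then (true ∷ ⊥) ∷ [] else []) ++ List.map (false ∷_) (singletons S)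

  xorList-map-false : ∀ {n} (L : List (Vec Bool n)) b x → xorList (List.map (false ∷_) L) (b ∷ x) ≡ xorList L x
  xorList-map-false [] b x = refl
  xorList-map-false (T ∷ L) b x = cong (monomial T x xor_) (xorList-map-false L b x)

  xorList-singletons : ∀ {n} (S x : Vec Bool n) → xorList (singletons S) x ≡ parity S x
  xorList-singletons [] [] = refl
  xorList-singletons (false ∷ S) (b ∷ x) = trans (xorList-map-false (singletons S) b x) (xorList-singletons S x)
  xorList-singletons (true ∷ S) (b ∷ x) =
    cong₂ _xor_ (trans (cong (b ∧_) (monomial-⊥ x)) (BoolP.∧-identityʳ b))
                (trans (xorList-map-false (singletons S) b x) (xorList-singletons S x))

  singletons-size : ∀ {n} (S : Vec Bool n) → All (λ T → ∣ T ∣ ≡ 1) (singletons S)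
  singletons-size [] = []
  singletons-size {suc n} (s ∷ S) = AllP.++⁺ (head s) (AllP.map⁺ (singletons-size S))
    where
    head : ∀ s → All (λ T → ∣ T ∣ ≡ 1) (if s then (true ∷ ⊥) ∷ [] else [])
    head true = cong suc (SP.∣⊥∣≡0 n) ∷ []
    head false = []

  twice-bit-sign : ∀ b p → + 2 * (bit b * sign p) ≡ sign p - + 1 * sign (b xor p)
  twice-bit-sign false false = refl
  twice-bit-sign false true = refl
  twice-bit-sign true false = refl
  twice-bit-sign true true = refl

  ℚ-zero-product : ∀ p q → p ℚ.* q ≡ 0ℚ → p ≡ 0ℚ ⊎ q ≡ 0ℚ
  ℚ-zero-product p q pq≡0 = Sum.map (ℚP.↥p≡0⇒p≡0 p) (ℚP.↥p≡0⇒p≡0 q) (ℤP.i*j≡0⇒i≡0∨j≡0 (↥ p)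
    (trans (sym (ℚP.↥-* p q)) (numerator-zero _ pq≡0)))
    where
    numerator-zero : ∀ {r} g → r ≡ 0ℚ → ↥ r * g ≡ + 0
    numerator-zero g refl = ℤP.*-zeroˡ g

  halfPow≢0 : ∀ k → ¬ halfPow k ≡ 0ℚ
  halfPow≢0 zero ()
  halfPow≢0 (suc k) e with ℚ-zero-product ½ (halfPow k) e
  ... | inj₁ ()
  ... | inj₂ e' = halfPow≢0 k e'

  /1≡0 : ∀ z → z ℚ./ 1 ≡ 0ℚ → z ≡ + 0
  /1≡0 z e = trans (sym (ℚP.↥-/ z 1)) (trans (cong (λ r → ↥ r * gcd z (+ 1)) e) (ℤP.*-zeroˡ (gcd z (+ 1))))

  fourier≢0 : ∀ {n} (h : Vec Bool n → ℤ) S → ¬ sumCube (λ x → h x * χ S x) ≡ + 0 → ¬ fourier h S ≡ 0ℚ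
  fourier≢0 {n} h S sum≢0 e with ℚ-zero-product _ (halfPow n) e
  ... | inj₁ e' = sum≢0 (/1≡0 _ e')
  ... | inj₂ e' = halfPow≢0 n e'

module Parity where

  open import Defs using (OddPrimePower)
  open CubeSums using (pow2)
  open import Data.Nat as ℕ using (ℕ; zero; suc; _≤_; _<_; _^_; z≤n; s≤s)
  import Data.Nat.Properties as ℕP
  open import Data.Nat.DivMod using (_%_; _/_; m≡m%n+[m/n]*n; m%n<n; [m+kn]%n≡m%n; m*n%n≡0)
  open import Data.Nat.Divisibility using (divides)
  open import Data.Nat.Divisibility.Core using (hasNonTrivialDivisor)
  open import Data.Nat.Primality using (Prime; prime⇒nonTrivial)
  open import Data.Nat.Tactic.RingSolver using (solve-∀)
  open import Data.Integer as ℤ using (ℤ; +_; -[1+_])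
  import Data.Integer.Properties as ℤP
  open import Data.Product using (∃; _×_; _,_)
  open import Relation.Nullary using (¬_; contradiction)
  open import Relation.Binary.PropositionalEquality
  open import Data.Integer.Solver using (module +-*-Solver)
  open +-*-Solver

  Odd : ℕ → Set
  Odd x = ∃ λ t → x ≡ suc (2 ℕ.* t)

  odd≢even : ∀ t r → ¬ suc (2 ℕ.* t) ≡ r ℕ.* 2
  odd≢even t r e = contradiction (begin
      1                       ≡⟨ sym ([m+kn]%n≡m%n 1 t 2) ⟩
      (1 ℕ.+ t ℕ.* 2) % 2     ≡⟨ cong (λ z → suc z % 2) (ℕP.*-comm t 2) ⟩
      suc (2 ℕ.* t) % 2       ≡⟨ cong (_% 2) e ⟩
      (r ℕ.* 2) % 2           ≡⟨ m*n%n≡0 r 2 ⟩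
      0                       ∎) λ ()
    where open ≡-Reasoning

  multiple≢oddResidue : ∀ k t q w →
    ¬ (w ℤ.* pow2 (suc k) ≡ pow2 k ℤ.* + suc (2 ℕ.* t) ℤ.+ q ℤ.* pow2 (suc k))
  multiple≢oddResidue k t q w e = not-multiple (w ℤ.- q) (begin
      X                           ≡⟨ solve 3 (λ X q Y → X := (X :+ q :* Y) :- q :* Y) refl X q Y ⟩
      (X ℤ.+ q ℤ.* Y) ℤ.- q ℤ.* Y ≡⟨ cong (ℤ._- q ℤ.* Y) (sym e) ⟩
      w ℤ.* Y ℤ.- q ℤ.* Y         ≡⟨ solve 3 (λ w q Y → w :* Y :- q :* Y := (w :- q) :* Y) refl w q Y ⟩
      (w ℤ.- q) ℤ.* Y             ∎)
    where
    open ≡-Reasoning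
    X = pow2 k ℤ.* + suc (2 ℕ.* t)
    Y = pow2 (suc k)
    odd≢2r : ∀ r → ¬ (+ suc (2 ℕ.* t) ≡ r ℤ.* + 2)
    odd≢2r (+ r') e' = odd≢even t r' (ℤP.+-injective (trans e' (sym (ℤP.pos-* r' 2))))
    odd≢2r -[1+ r' ] ()
    not-multiple : ∀ r → ¬ (X ≡ r ℤ.* Y)
    not-multiple r e' = odd≢2r r (ℤP.*-cancelˡ-≡ (pow2 k) (+ suc (2 ℕ.* t)) (r ℤ.* + 2) ⦃ ℕP.m^n≢0 2 k ⦄
      (trans e' (trans (cong (r ℤ.*_) (ℤP.pos-* 2 (2 ^ k)))
        (trans (sym (ℤP.*-assoc r (+ 2) (pow2 k))) (ℤP.*-comm (r ℤ.* + 2) (pow2 k))))))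

  odd-* : ∀ a b → Odd a → Odd b → Odd (a ℕ.* b)
  odd-* a b (s , refl) (t , refl) = s ℕ.+ t ℕ.+ 2 ℕ.* (s ℕ.* t) , expand s t
    where
    expand : ∀ s t → suc (2 ℕ.* s) ℕ.* suc (2 ℕ.* t) ≡ suc (2 ℕ.* (s ℕ.+ t ℕ.+ 2 ℕ.* (s ℕ.* t)))
    expand = solve-∀

  odd-^ : ∀ a k → Odd a → Odd (a ^ k)
  odd-^ a zero _ = 0 , refl
  odd-^ a (suc k) odd = odd-* a (a ^ k) odd (odd-^ a k odd)

  -- A prime other than 2 is odd (2 would be a nontrivial divisor) and at least 3.
  oddPrime : ∀ p → Prime p → ¬ p ≡ 2 → Odd p × 3 ≤ p
  oddPrime p p-prime p≢2 = parity (p % 2) (m%n<n p 2) (m≡m%n+[m/n]*n p 2) , 3≤p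
    where
    3≤p : 3 ≤ p
    3≤p = ℕP.≤∧≢⇒< (ℕ.nonTrivial⇒n>1 p ⦃ prime⇒nonTrivial p-prime ⦄) (λ e → p≢2 (sym e))
    parity : ∀ r → r < 2 → p ≡ r ℕ.+ (p / 2) ℕ.* 2 → Odd p
    parity zero _ e = contradiction (hasNonTrivialDivisor {divisor = 2} 3≤p (divides (p / 2) e)) (Prime.notComposite p-prime)
    parity (suc zero) _ e = p / 2 , trans e (cong suc (ℕP.*-comm (p / 2) 2))
    parity (suc (suc r)) (s≤s (s≤s ())) e

  oddPrimePower : ∀ d → OddPrimePower d → Odd d × 3 ≤ d
  oddPrimePower d (p , k , p-prime , p≢2 , 1≤k , refl) with oddPrime p p-prime p≢2
  ... | odd , 3≤p = odd-^ p k odd , ℕP.≤-trans 3≤p p≤p^k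
    where
    p≤p^k : p ≤ p ^ k
    p≤p^k = ℕP.≤-trans (ℕP.≤-reflexive (sym (ℕP.*-identityʳ p)))
                       (ℕP.^-monoʳ-≤ p ⦃ ℕ.>-nonZero (ℕP.≤-trans (s≤s z≤n) 3≤p) ⦄ 1≤k)

module AllCoefficientsNonzero {d : ℕ} (oddPP : Defs.OddPrimePower d) (F : FiniteField d) (m' n : ℕ)
  (n≡ : n ≡ Data.Nat._*_ (suc m') (Data.Nat._*_ d d))
  (pile : (Fin (suc m') × FiniteField.Carrier F × FiniteField.Carrier F) ↔ Fin n)
  (f c : Vec Bool n → Bool) (f≡c : ∀ x → f x ≡ Defs.evalGF2 c x)
  (deg≤d : ∀ T → c T ≡ true → ∣ T ∣ Data.Nat.≤ d)
  (top⇔line : ∀ T → (c T ≡ true × ∣ T ∣ ≡ d) ⇔ Lines.IsLine F (suc m') n pile T) where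

  open import Defs
  open CubeSums
  open TwoAdic using (CongruentMod)
  open ListFacts using (filterᵇ-∧)
  open FourierSide
  open Parity
  open import Data.Bool using (_xor_)
  import Data.Bool as 𝔹
  open import Data.Bool.Properties using (T-≡)
  open import Data.Nat as ℕ using (_^_; _≤_; z≤n; s≤s)
  import Data.Nat.Properties as ℕP
  open import Data.Integer using (+_; _+_; _*_; _-_)
  import Data.Integer.Properties as ℤP
  open import Data.Rational using (0ℚ)
  open import Data.List as List using (List; []; _++_; filterᵇ)
  import Data.List.Properties as LP
  open import Data.List.Relation.Unary.All as All using (All)
  import Data.List.Relation.Unary.All.Properties as AllP
  open import Data.Fin.Subset using (⊥; ∁)
  import Data.Fin.Subset.Properties as SP
  open import Data.Product using (∃; _,_; proj₁; proj₂)
  open import Data.Sum using (inj₁; inj₂)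
  open import Relation.Nullary using (¬_)
  open import Relation.Binary.PropositionalEquality
  open import Function.Bundles using (Equivalence)
  open import Data.Integer.Solver using (module +-*-Solver)
  open +-*-Solver

  m k : ℕ
  m = suc m'
  k = m ℕ.* d

  n≡kd : n ≡ k ℕ.* d
  n≡kd = trans n≡ (sym (ℕP.*-assoc m d d))

  3≤d : 3 ≤ d
  3≤d = proj₂ (oddPrimePower d oddPP)

  2≤d : 2 ≤ d
  2≤d = ℕP.≤-trans (s≤s (s≤s z≤n)) 3≤d

  dᵐ-odd : Odd (d ^ m)
  dᵐ-odd = odd-^ d m (proj₁ (oddPrimePower d oddPP))

  open TwoAdic.Schedule n k d n≡kd 2≤d using (fullChains; incExc-mod)
  open ChainsAsCovers.Schedule n k d n≡kd 2≤d
    using (isTop; fullChains-topDegree; fullChains-↭; fullChains≡exactCovers)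
  open LineConfiguration F m n pile c top⇔line
    using (topMonomial; allLines; topMonomials↭allLines; allLines-size; exactCovers-allLines)

  -- n = k d ≥ 2 k ≥ k + 1, as k ≥ 1.
  k<n : ∃ λ r → suc k ℕ.+ r ≡ n
  k<n = ℕP.m≤n⇒∃[o]m+o≡n (begin
      suc k          ≤⟨ ℕP.+-monoˡ-≤ k (ℕP.≤-trans (ℕP.≤-trans (s≤s z≤n) 2≤d) (ℕP.m≤m+n d (m' ℕ.* d))) ⟩
      k ℕ.+ k        ≡⟨ cong (k ℕ.+_) (sym (ℕP.*-identityʳ k)) ⟩
      k ℕ.+ k ℕ.* 1  ≡⟨ sym (ℕP.*-suc k 1) ⟩
      k ℕ.* 2        ≤⟨ ℕP.*-monoʳ-≤ k 2≤d ⟩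
      k ℕ.* d        ≡⟨ sym n≡kd ⟩
      n              ∎)
    where open ℕP.≤-Reasoning

  ∣⊥∣≡d*0 : ∣ ⊥ {n} ∣ ≡ d ℕ.* 0
  ∣⊥∣≡d*0 = trans (SP.∣⊥∣≡0 n) (sym (ℕP.*-zeroʳ d))

  module _ (S : Vec Bool n) where

    monomials : List (Vec Bool n)
    monomials = filterᵇ c (cube n) ++ singletons S

    monomials-xor : ∀ x → xorList monomials x ≡ f x xor parity S x
    monomials-xor x = trans (xorList-++ (filterᵇ c (cube n)) (singletons S) x)
      (cong₂ _xor_ (trans (sym (evalGF2-monomials c x)) (sym (f≡c x))) (xorList-singletons S x))

    monomials-degree : All (λ T → ∣ T ∣ ≤ d) monomials
    monomials-degree = AllP.++⁺
      (All.map (λ {T} cT → deg≤d T (Equivalence.to T-≡ cT)) (AllP.all-filter _ (cube n)))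
      (All.map (λ size≡1 → ℕP.≤-trans (ℕP.≤-reflexive size≡1) (ℕP.≤-trans (s≤s z≤n) 2≤d)) (singletons-size S))

    -- The singletons have degree 1 < d, so the top-degree part is that of c.
    monomials-top : filterᵇ isTop monomials ≡ filterᵇ topMonomial (cube n)
    monomials-top = begin
        filterᵇ isTop monomials
      ≡⟨ LP.filter-++ _ (filterᵇ c (cube n)) (singletons S) ⟩
        filterᵇ isTop (filterᵇ c (cube n)) ++ filterᵇ isTop (singletons S)
      ≡⟨ cong₂ _++_ (filterᵇ-∧ c isTop (cube n)) (LP.filter-none _ (All.map (λ {T} → not-top {T}) (singletons-size S))) ⟩
        filterᵇ topMonomial (cube n) ++ []
      ≡⟨ LP.++-identityʳ _ ⟩
        filterᵇ topMonomial (cube n) ∎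
      where
      open ≡-Reasoning
      not-top : ∀ {T} → ∣ T ∣ ≡ 1 → ¬ 𝔹.T (isTop T)
      not-top {T} size≡1 top = ℕP.<-irrefl (trans (sym size≡1) (ℕP.≡ᵇ⇒≡ ∣ T ∣ d top)) (ℕP.≤-trans (s≤s (s≤s z≤n)) 3≤d)

    fullChains-monomials : fullChains monomials ⊥ 0 ≡ d ^ m
    fullChains-monomials = begin
        fullChains monomials ⊥ 0
      ≡⟨ fullChains-topDegree monomials monomials-degree ⊥ 0 (ℕP.≤-reflexive ∣⊥∣≡d*0) ⟩
        fullChains (filterᵇ isTop monomials) ⊥ 0
      ≡⟨ cong (λ L → fullChains L ⊥ 0) monomials-top ⟩
        fullChains (filterᵇ topMonomial (cube n)) ⊥ 0
      ≡⟨ fullChains-↭ topMonomials↭allLines ⊥ 0 ⟩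
        fullChains allLines ⊥ 0
      ≡⟨ fullChains≡exactCovers allLines allLines-size ⊥ 0 ∣⊥∣≡d*0 ⟩
        ChainsAsCovers.exactCovers allLines (∁ ⊥)
      ≡⟨ exactCovers-allLines ⟩
        d ^ m ∎
      where open ≡-Reasoning

    signSum-mod : CongruentMod (pow2 (suc k)) (sumCube (λ x → sign (f x xor parity S x))) (pow2 k * + (d ^ m))
    signSum-mod with incExc-mod monomials monomials-degree ⊥ 0 (ℕP.≤-reflexive ∣⊥∣≡d*0)
    ... | q , e = q , (begin
        sumCube (λ x → sign (f x xor parity S x))
      ≡⟨ sumOver-cong (cube n) (λ x → cong sign (sym (monomials-xor x))) ⟩
        sumCube (λ x → sign (xorList monomials x))
      ≡⟨ sym (incExc-⊥ monomials) ⟩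
        incExc monomials ⊥
      ≡⟨ sym (ℤP.*-identityˡ _) ⟩
        pow2 0 * incExc monomials ⊥
      ≡⟨ e ⟩
        pow2 k * + fullChains monomials ⊥ 0 + q * pow2 (suc k)
      ≡⟨ cong (λ w → pow2 k * + w + q * pow2 (suc k)) fullChains-monomials ⟩
        pow2 k * + (d ^ m) + q * pow2 (suc k) ∎)
      where open ≡-Reasoning

    twice-numerator : + 2 * sumCube (λ x → bit (f x) * χ S x)
      ≡ sumCube (λ x → sign (parity S x)) - + 1 * sumCube (λ x → sign (f x xor parity S x))
    twice-numerator = begin
        + 2 * sumCube (λ x → bit (f x) * χ S x)
      ≡⟨ sym (sumOver-scale (cube n) (λ x → bit (f x) * χ S x) (+ 2)) ⟩
        sumCube (λ x → + 2 * (bit (f x) * χ S x))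
      ≡⟨ sumOver-cong (cube n) (λ x → twice-bit-sign (f x) (parity S x)) ⟩
        sumCube (λ x → sign (parity S x) - + 1 * sign (f x xor parity S x))
      ≡⟨ sumOver-linear (cube n) _ _ (+ 1) ⟩
        sumCube (λ x → sign (parity S x)) - + 1 * sumCube (λ x → sign (f x xor parity S x)) ∎
      where open ≡-Reasoning

    -- ∑ₓ χ_S(x) ∈ {0, 2ⁿ} is a multiple of 2^{k+1}, as n ≥ k + 1.
    characterSum-multiple : ∃ λ w → w * pow2 (suc k) ≡ sumCube (λ x → sign (parity S x))
    characterSum-multiple with characterSum S
    ... | inj₁ A≡0 = + 0 , trans (ℤP.*-zeroˡ (pow2 (suc k))) (sym A≡0)
    ... | inj₂ A≡2ⁿ = pow2 r , (begin
          pow2 r * pow2 (suc k)   ≡⟨ ℤP.*-comm (pow2 r) _ ⟩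
          pow2 (suc k) * pow2 r   ≡⟨ sym (pow2-+ (suc k) r) ⟩
          pow2 (suc k ℕ.+ r)      ≡⟨ cong pow2 (proj₂ k<n) ⟩
          pow2 n                  ≡⟨ sym A≡2ⁿ ⟩
          sumCube (λ x → sign (parity S x)) ∎)
      where
      open ≡-Reasoning
      r = proj₁ k<n

    -- If the numerator vanished, the sign sum would equal the character sum,
    -- a multiple of 2^{k+1}, while it is 2ᵏ times an odd number modulo 2^{k+1}.
    numerator≢0 : ¬ sumCube (λ x → bit (f x) * χ S x) ≡ + 0
    numerator≢0 Z≡0 with characterSum-multiple | signSum-mod | dᵐ-odd
    ... | w , wY≡A | q , B≡ | t , dᵐ≡ = multiple≢oddResidue k t q w (begin
        w * pow2 (suc k)                               ≡⟨ wY≡A ⟩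
        A                                              ≡⟨ solve 2 (λ a b → a := (a :- con (+ 1) :* b) :+ b) refl A B ⟩
        (A - + 1 * B) + B                              ≡⟨ cong (_+ B) (sym twice-numerator) ⟩
        + 2 * Z + B                                    ≡⟨ cong (λ z → + 2 * z + B) Z≡0 ⟩
        + 0 + B                                        ≡⟨ ℤP.+-identityˡ B ⟩
        B                                              ≡⟨ B≡ ⟩
        pow2 k * + (d ^ m) + q * pow2 (suc k)          ≡⟨ cong (λ v → pow2 k * + v + q * pow2 (suc k)) dᵐ≡ ⟩
        pow2 k * + suc (2 ℕ.* t) + q * pow2 (suc k)    ∎)
      where
      open ≡-Reasoning
      Z = sumCube (λ x → bit (f x) * χ S x)
      A = sumCube (λ x → sign (parity S x))
      B = sumCube (λ x → sign (f x xor parity S x))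

  coefficient≢0 : ∀ S → ¬ fourier (λ x → bit (f x)) S ≡ 0ℚ
  coefficient≢0 S = fourier≢0 (λ x → bit (f x)) S (numerator≢0 S)

open import Defs
open import Data.Bool using (Bool; true)
open import Data.Nat using (ℕ; _*_; _∸_; _^_; _≤_)
open import Data.Fin using (Fin)
open import Data.Fin.Subset using (∣_∣)
open import Data.Vec using (Vec; lookup)
open import Data.Product using (∃; _×_; _,_; proj₁; proj₂)
open import Relation.Binary.PropositionalEquality using (_≡_)
open import Function.Bundles using (_↔_; _⇔_; Inverse)
open import Data.Nat using (zero; z≤n)
open import Data.Nat.Properties using (m∸n≤m; module ≤-Reasoning)
open import Data.List using (length)
open import Data.List.Properties using (filter-all)
import Data.List.Relation.Unary.All as All
open import Relation.Binary.PropositionalEquality using (refl; sym; cong)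

-- Theorem 6.2.  With no piles n = 0 and the bound is 0; otherwise every one of
-- the 2ⁿ Fourier coefficients is nonzero.
theorem6p2 : (d : ℕ) → OddPrimePower d → (F : FiniteField d) →
    (m n : ℕ) → n ≡ m * (d * d) →
    (pile : (Fin m × FiniteField.Carrier F × FiniteField.Carrier F) ↔ Fin n) →
    (f : Vec Bool n → Bool) → (c : Vec Bool n → Bool) →
    (∀ x → f x ≡ evalGF2 c x) →
    (∀ T → c T ≡ true → ∣ T ∣ ≤ d) →
    (∀ T → (c T ≡ true × ∣ T ∣ ≡ d) ⇔
      (∃ λ p → ∃ λ a → ∃ λ b → ∀ i → lookup T i ≡ true ⇔
        (proj₁ (Inverse.from pile i) ≡ p ×
         proj₂ (proj₂ (Inverse.from pile i)) ≡
           FiniteField._+_ F (FiniteField._*_ F a (proj₁ (proj₂ (Inverse.from pile i)))) b))) →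
    2 ^ n ∸ 1 ≤ sparsity (λ x → bit (f x))
theorem6p2 d oddPP F zero n refl pile f c f≡c deg≤d top⇔line = z≤n
theorem6p2 d oddPP F (suc m') n n≡ pile f c f≡c deg≤d top⇔line = begin
    2 ^ n ∸ 1                   ≤⟨ m∸n≤m (2 ^ n) 1 ⟩
    2 ^ n                       ≡⟨ sym (ListFacts.length-cube n) ⟩
    length (cube n)             ≡⟨ cong length (sym (filter-all _ {cube n} (All.tabulate λ {S} _ → coefficient≢0 S))) ⟩
    sparsity (λ x → bit (f x))  ∎
  where
  open ≤-Reasoning
  open AllCoefficientsNonzero oddPP F m' n n≡ pile f c f≡c deg≤d top⇔line using (coefficient≢0)
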